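{- If $D$ is a digraph and $D'$ is a butterfly minor of $D$, then $\mathrm{cycw}(D')\le\mathrm{cycw}(D)$.
   Context: For $X\subseteq V(D)$, $\partial(X)$ is the set of arcs with exactly one endpoint in $X$. A cycle decomposition of $D$ is $(T,\varphi)$, $T$ a cubic tree (non-leaf vertices of degree $3$), $\varphi$ a bijection from the leaves of $T$ to $V(D)$; for $e\in E(T)$, $\partial(e)=\partial(\varphi(\text{leaves of }T_1))$ with $T_1$ a component of $T-e$; its cycle porosity is the maximum over families $\mathcal{C}$ of pairwise vertex-disjoint directed cycles of $D$ of $|\partial(e)\cap\bigcup_{C\in\mathcal C}E(C)|$. The width is the maximum cycle porosity over tree edges; $\mathrm{cycw}(D)$ is the minimum width of a cycle decomposition. An arc $(u,v)$ is butterfly-contractible if it is the only arc leaving $u$ or the only arc entering $v$; butterfly contracting it replaces $u,v$ by a new vertex $x_{u,v}$ with arcs $(w,x_{u,v})$ whenever $(w,u)$ or $(w,v)$ was an arc and $(x_{u,v},w)$ whenever $(u,w)$ or $(v,w)$ was an arc. A butterfly minor of $D$ is a digraph obtained from a subgraph of $D$ by butterfly contractions. -}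

module Defs where

open import Data.Nat using (ℕ; _≤_; _<_)
open import Data.Bool using (Bool; true; false; _∧_; _∨_; not)
open import Data.Fin using (Fin; _≟_)
open import Data.List using (List; []; _∷_; _++_; zip; length; filter)
open import Data.List.Membership.Propositional using (_∈_)
open import Data.List.Relation.Unary.All using (All)
open import Data.List.Relation.Unary.Any using (Any)
open import Data.List.Relation.Unary.AllPairs using (AllPairs)
open import Data.List.Relation.Unary.Unique.Propositional using (Unique)
open import Data.List.Relation.Binary.Disjoint.Propositional using (Disjoint)
open import Data.List.Base using (allFin)
open import Data.Product using (Σ; _×_; _,_; proj₁; ∃)
open import Data.Sum using (_⊎_)
open import Relation.Nullary using (¬_)
open import Relation.Nullary.Decidable using (⌊_⌋)
open import Relation.Binary.PropositionalEquality using (_≡_)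
open import Relation.Binary.Construct.Closure.ReflexiveTransitive using (Star)
open import Function.Bundles using (_↔_; Inverse)
open import Function.Definitions using (Injective)

record Digraph : Set where
  field
    n        : ℕ
    arc      : Fin n → Fin n → Bool
    loopless : ∀ x → arc x x ≡ false
open Digraph public

cyclicPairs : {A : Set} → List A → List (A × A)
cyclicPairs []         = []
cyclicPairs (v ∷ rest) = zip (v ∷ rest) (rest ++ (v ∷ []))

data NonEmpty {A : Set} : List A → Set where
  nonEmpty : ∀ {x xs} → NonEmpty (x ∷ xs)

IsCycle : {m : ℕ} → (Fin m → Fin m → Bool) → List (Fin m) → Set
IsCycle R vs = NonEmpty vs × Unique vs
             × All (λ p → R (Data.Product.proj₁ p) (Data.Product.proj₂ p) ≡ true)
                   (cyclicPairs vs)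

-- directed cycles of D; E(C) = cyclicPairs of its vertex list
DCycle : Digraph → Set
DCycle D = Σ (List (Fin (n D))) (IsCycle (arc D))

data Reach {m : ℕ} (R : Fin m → Fin m → Bool) : Fin m → Fin m → Set where
  here : ∀ {a} → Reach R a a
  step : ∀ {a b c} → R a b ≡ true → Reach R b c → Reach R a c

_==_ : {m : ℕ} → Fin m → Fin m → Bool
x == y = ⌊ x ≟ y ⌋

removeEdge : {m : ℕ} → (Fin m → Fin m → Bool) → Fin m → Fin m
           → Fin m → Fin m → Bool
removeEdge adj a b x y =
  adj x y ∧ not (((x == a) ∧ (y == b)) ∨ ((x == b) ∧ (y == a)))

degree : {m : ℕ} → (Fin m → Fin m → Bool) → Fin m → ℕ
degree {m} adj a = length (filter (λ b → adj a b ≡? true) (allFin m))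
  where
    open import Data.Bool.Properties using () renaming (_≟_ to _≡?_)

record CubicTree : Set where
  field
    m         : ℕ
    adj       : Fin m → Fin m → Bool
    symmetric : ∀ a b → adj a b ≡ adj b a
    irrefl    : ∀ a → adj a a ≡ false
    connected : ∀ a b → Reach adj a b
    acyclic   : ∀ vs → IsCycle adj vs → length vs < 3
    cubic     : ∀ a → degree adj a ≤ 1 ⊎ degree adj a ≡ 3
open CubicTree public

Leaf : CubicTree → Set
Leaf T = Σ (Fin (m T)) (λ a → degree (adj T) a ≤ 1)

record CycleDecomposition (D : Digraph) : Set where
  field
    tree : CubicTree
    φ    : Leaf tree ↔ Fin (n D)
open CycleDecomposition public

Crossing : {A : Set} → (A → Set) → A × A → Set
Crossing X (x , y) = (X x × ¬ X y) ⊎ (¬ X x × X y)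

DisjointFamily : (D : Digraph) → List (DCycle D) → Set
DisjointFamily D F = AllPairs (λ C C′ → Disjoint (proj₁ C) (proj₁ C′)) F

InFamily : (D : Digraph) → List (DCycle D) → Fin (n D) × Fin (n D) → Set
InFamily D F p = Any (λ C → p ∈ cyclicPairs (proj₁ C)) F

-- the cycle porosity of the cut ∂(X) is at most k:
-- for every family 𝒞 of pairwise vertex-disjoint directed cycles,
-- |∂(X) ∩ ⋃ E(C)| ≤ k  (every duplicate-free list of such arcs has length ≤ k)
PorosityAtMost : (D : Digraph) → (Fin (n D) → Set) → ℕ → Set
PorosityAtMost D X k =
  (F : List (DCycle D)) → DisjointFamily D F →
  (L : List (Fin (n D) × Fin (n D))) → Unique L →
  All (λ p → Crossing X p × InFamily D F p) L → length L ≤ k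

-- side of the tree edge {a , b}: leaves (as vertices of D, via φ)
-- in the component of T − ab containing a
edgeSide : {D : Digraph} (dec : CycleDecomposition D) →
           Fin (m (tree dec)) → Fin (m (tree dec)) → Fin (n D) → Set
edgeSide dec a b v =
  Reach (removeEdge (adj (tree dec)) a b) a (proj₁ (Inverse.from (φ dec) v))

WidthAtMost : (D : Digraph) → CycleDecomposition D → ℕ → Set
WidthAtMost D dec k =
  ∀ a b → adj (tree dec) a b ≡ true → PorosityAtMost D (edgeSide dec a b) k

CycwAtMost : Digraph → ℕ → Set
CycwAtMost D k = Σ (CycleDecomposition D) (λ dec → WidthAtMost D dec k)

Subgraph : Digraph → Digraph → Set
Subgraph H D = Σ (Fin (n H) → Fin (n D)) λ ι →
  Injective _≡_ _≡_ ι × (∀ x y → arc H x y ≡ true → arc D (ι x) (ι y) ≡ true)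

ButterflyContractible : (D : Digraph) → Fin (n D) → Fin (n D) → Set
ButterflyContractible D u v =
  arc D u v ≡ true ×
  ((∀ w → arc D u w ≡ true → w ≡ v) ⊎ (∀ w → arc D w v ≡ true → w ≡ u))

-- D′ is (isomorphic to) the result of butterfly contracting some
-- butterfly-contractible arc (u , v) of D: f : V(D) → V(D′) identifies
-- exactly u and v (to x_{u,v}) and is otherwise a bijection; arcs of D′ are
-- images of arcs of D not having both ends in {u , v}.
ContractionStep : Digraph → Digraph → Set
ContractionStep D D′ =
  Σ (Fin (n D)) λ u → Σ (Fin (n D)) λ v → ButterflyContractible D u v ×
  Σ (Fin (n D) → Fin (n D′)) λ f →
    f u ≡ f v ×
    (∀ y → ∃ λ x → f x ≡ y) ×
    (∀ x y → f x ≡ f y → x ≡ y ⊎ ((x ≡ u ⊎ x ≡ v) × (y ≡ u ⊎ y ≡ v))) ×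
    (∀ p q → arc D′ p q ≡ true →
       Σ (Fin (n D)) λ x → Σ (Fin (n D)) λ y →
         f x ≡ p × f y ≡ q × arc D x y ≡ true ×
         ¬ ((x ≡ u ⊎ x ≡ v) × (y ≡ u ⊎ y ≡ v))) ×
    (∀ x y → arc D x y ≡ true → ¬ ((x ≡ u ⊎ x ≡ v) × (y ≡ u ⊎ y ≡ v)) →
       arc D′ (f x) (f y) ≡ true)

ButterflyMinor : Digraph → Digraph → Set
ButterflyMinor D′ D = Σ Digraph λ H → Subgraph H D × Star ContractionStep H D′

-- Both kinds of butterfly-minor steps admit an injection g : V(D′) → V(D) along which
-- cycle porosity pulls back: for a subgraph, g is the inclusion; for a contraction of
-- the arc u v onto x₀, g is a section of the contraction map choosing an endpoint over x₀.
-- Every family of disjoint cycles of D′ lifts to one of D, an arc at x₀ that does not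
-- lift being replaced by a path through the other endpoint, one of whose two arcs still
-- crosses the cut; this maps the arcs counted in the pulled-back cut injectively to arcs
-- counted in the original cut. A cycle decomposition of D then restricts to one of D′
-- of no larger width: delete the leaves outside the image of g one at a time,
-- suppressing each resulting vertex of degree 2, so that every edge of the new tree
-- splits the remaining leaves as some edge of the old tree does.

module Submission where

open import Defs
open import Data.Nat using (ℕ; zero; suc; _+_; _≤_; _<_; z≤n; s≤s; _≤?_)
import Data.Nat.Properties as ℕ
open import Algebra.Properties.CommutativeSemigroup ℕ.+-commutativeSemigroup
  using () renaming (x∙yz≈y∙xz to x+[y+z]≡y+[x+z])
open import Data.Bool using (Bool; true; false; _∧_; _∨_; not)
open import Data.Bool.Properties using (∨-comm; ∧-comm; ∨-identityʳ; ∨-zeroʳ) renaming (_≟_ to _≟ᵇ_)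
open import Data.Fin using (Fin; zero; suc; punchIn; punchOut) renaming (_≟_ to _≟ᶠ_)
open import Data.Fin.Properties
  using (punchIn-injective; punchInᵢ≢i; punchIn-punchOut; punchOut-cong; punchOut-punchIn; punchOut-injective;
         injective⇒≤; ¬∀⟶∃¬)
  renaming (any? to anyᶠ?; all? to allᶠ?)
import Data.List as List
open import Data.List using (List; []; _∷_; _++_; zip; length; filter; map; initLast; _∷ʳ′_)
open import Data.List.Properties using (length-map; map-++; zip-map; ++-identityʳ)
open import Data.List.Membership.Propositional using (_∈_)
open import Data.List.Membership.Propositional.Properties using (∈-map⁺; ∈-map⁻; ∈-++⁻; ∈-∃++)
open import Data.List.Relation.Unary.All as All using (All; []; _∷_; lookup; tabulate)
import Data.List.Relation.Unary.All.Properties as All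
open import Data.List.Relation.Unary.Any using (Any; here; there; any?)
open import Data.List.Relation.Unary.AllPairs as AllPairs using (AllPairs; []; _∷_)
import Data.List.Relation.Unary.AllPairs.Properties as AllPairs
open import Data.List.Relation.Unary.Unique.Propositional using (Unique)
import Data.List.Relation.Unary.Unique.Propositional.Properties as Unique
open import Data.List.Relation.Binary.Disjoint.Propositional using (Disjoint)
open import Data.List.Relation.Binary.Permutation.Propositional
  using (_↭_; ↭-sym; ↭-trans; ↭-reflexive; ↭⇒↭ₛ; module PermutationReasoning)
open import Data.List.Relation.Binary.Permutation.Propositional.Properties using (++-comm; ∈-resp-↭; All-resp-↭)
import Data.List.Relation.Binary.Permutation.Setoid.Properties as Permutationₛ
import Data.Product as Product
open import Data.Product using (Σ; _×_; _,_; proj₁; proj₂; ∃)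
open import Data.Sum using (_⊎_; inj₁; inj₂; [_,_])
open import Data.Empty using (⊥; ⊥-elim)
open import Relation.Nullary using (¬_; yes; no; Dec)
open import Relation.Nullary.Decidable using (¬¬-excluded-middle)
open import Relation.Binary.PropositionalEquality hiding ([_])
open import Relation.Binary.Construct.Closure.ReflexiveTransitive using (fold)
open import Function using (_∘_; id)
open import Function.Bundles using (_↔_; _⇔_; Inverse; Equivalence; mk↔ₛ′; mk⇔)
open import Function.Definitions using (Injective)
open import Function.Construct.Composition using (_⇔-∘_)
open import Function.Construct.Symmetry using (⇔-sym)

Rel₂ : ℕ → Set
Rel₂ m = Fin m → Fin m → Bool

-- the arcs of the walk a, vs, e; note cyclicPairs (v ∷ vs) = pathPairs v vs v
pathPairs : ∀ {A : Set} → A → List A → A → List (A × A)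
pathPairs a vs e = zip (a ∷ vs) (vs ++ e ∷ [])

true≢false : true ≡ false → ⊥
true≢false ()

==-refl : ∀ {m} (x : Fin m) → (x == x) ≡ true
==-refl x with x ≟ᶠ x
... | yes _   = refl
... | no  x≢x = ⊥-elim (x≢x refl)

==-≢ : ∀ {m} {x y : Fin m} → ¬ x ≡ y → (x == y) ≡ false
==-≢ {x = x} {y} x≢y with x ≟ᶠ y
... | yes x≡y = ⊥-elim (x≢y x≡y)
... | no  _   = refl

bit : Bool → ℕ
bit true  = 1
bit false = 0

count : ∀ {m} → (Fin m → Bool) → ℕ
count {zero}  f = 0
count {suc m} f = bit (f zero) + count (f ∘ suc)

degree≡count : ∀ {m} (A : Rel₂ m) x → degree A x ≡ count (A x)
degree≡count {m} A x = go m id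
  where
  go : ∀ k (h : Fin k → Fin m) →
       length (filter (λ y → A x y ≟ᵇ true) (List.tabulate h)) ≡ count (A x ∘ h)
  go zero    h = refl
  go (suc k) h with A x (h zero)
  ... | true  = cong suc (go k (h ∘ suc))
  ... | false = go k (h ∘ suc)

count-cong : ∀ {m} {f g : Fin m → Bool} → (∀ x → f x ≡ g x) → count f ≡ count g
count-cong {zero}  eq = refl
count-cong {suc m} eq = cong₂ _+_ (cong bit (eq zero)) (count-cong (eq ∘ suc))

count-punchIn : ∀ {m} (f : Fin (suc m) → Bool) i → count f ≡ bit (f i) + count (f ∘ punchIn i)
count-punchIn f zero = refl
count-punchIn {suc m} f (suc i) = begin
  bit (f zero) + count (f ∘ suc)
    ≡⟨ cong (bit (f zero) +_) (count-punchIn (f ∘ suc) i) ⟩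
  bit (f zero) + (bit (f (suc i)) + count (f ∘ suc ∘ punchIn i))
    ≡⟨ x+[y+z]≡y+[x+z] (bit (f zero)) (bit (f (suc i))) _ ⟩
  bit (f (suc i)) + (bit (f zero) + count (f ∘ suc ∘ punchIn i)) ∎
  where open ≡-Reasoning

count-const-false : ∀ {m} → count {m} (λ _ → false) ≡ 0
count-const-false {zero}  = refl
count-const-false {suc m} = count-const-false {m}

count-pos : ∀ {m} (f : Fin m → Bool) x → f x ≡ true → 1 ≤ count f
count-pos {suc m} f x fx rewrite count-punchIn f x | fx = s≤s z≤n

count-pos⁻ : ∀ {m} (f : Fin m → Bool) → 1 ≤ count f → ∃ λ x → f x ≡ true
count-pos⁻ {suc m} f le with f zero in fz
... | true  = zero , fz
... | false = let x , fx = count-pos⁻ (f ∘ suc) le in suc x , fx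

count≤1⇒unique : ∀ {m} (f : Fin m → Bool) → count f ≤ 1 →
                 ∀ {x y} → f x ≡ true → f y ≡ true → x ≡ y
count≤1⇒unique {suc m} f c {x} {y} fx fy with x ≟ᶠ y
... | yes x≡y = x≡y
... | no  x≢y with count-pos (f ∘ punchIn x) (punchOut x≢y) (trans (cong f (punchIn-punchOut x≢y)) fy)
... | le rewrite count-punchIn f x | fx = ⊥-elim (ℕ.<⇒≱ (s≤s le) c)

count-∨-single : ∀ {k} (f : Fin k → Bool) i → f i ≡ false →
                 count (λ y → f y ∨ (y == i)) ≡ suc (count f)
count-∨-single {suc k} f i fi = begin
  count (λ y → f y ∨ (y == i))
    ≡⟨ count-punchIn (λ y → f y ∨ (y == i)) i ⟩
  bit (f i ∨ (i == i)) + count (λ z → f (punchIn i z) ∨ (punchIn i z == i))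
    ≡⟨ cong₂ _+_ (cong bit (trans (cong (_∨ (i == i)) fi) (==-refl i)))
                 (count-cong λ z → trans (cong (f (punchIn i z) ∨_) (==-≢ (punchInᵢ≢i i z)))
                                         (∨-identityʳ _)) ⟩
  suc (count (f ∘ punchIn i))
    ≡⟨ cong (λ b → suc (bit b + count (f ∘ punchIn i))) (sym fi) ⟩
  suc (bit (f i) + count (f ∘ punchIn i))
    ≡⟨ cong suc (sym (count-punchIn f i)) ⟩
  suc (count f) ∎
  where open ≡-Reasoning

count-drop : ∀ {m} (f : Fin (suc m) → Bool) {i} → f i ≡ true → count f ≡ suc (count (f ∘ punchIn i))
count-drop f {i} fi = trans (count-punchIn f i) (cong (λ β → bit β + count (f ∘ punchIn i)) fi)

punchIn-view : ∀ {m} (i y : Fin (suc m)) → y ≡ i ⊎ ∃ λ z → punchIn i z ≡ y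
punchIn-view i y with i ≟ᶠ y
... | yes i≡y = inj₁ (sym i≡y)
... | no  i≢y = inj₂ (punchOut i≢y , punchIn-punchOut i≢y)

record OtherTwo {m} (f : Fin m → Bool) (i : Fin m) : Set where
  field
    a b   : Fin m
    fa    : f a ≡ true
    fb    : f b ≡ true
    a≢b   : a ≢ b
    a≢i   : a ≢ i
    b≢i   : b ≢ i
    only  : ∀ y → f y ≡ true → y ≡ i ⊎ y ≡ a ⊎ y ≡ b

count≡3⇒otherTwo : ∀ {m} (f : Fin (suc (suc (suc m))) → Bool) {i} → f i ≡ true → count f ≡ 3 → OtherTwo f i
count≡3⇒otherTwo {m} f {i} fi c₃ = record
  { a    = punchIn i a₁
  ; b    = punchIn i (punchIn a₁ b₁)
  ; fa   = fa₁
  ; fb   = fb₁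
  ; a≢b  = λ e → punchInᵢ≢i a₁ b₁ (sym (punchIn-injective i _ _ e))
  ; a≢i  = punchInᵢ≢i i a₁
  ; b≢i  = punchInᵢ≢i i _
  ; only = only
  }
  where
  c₂ : count (f ∘ punchIn i) ≡ 2
  c₂ = ℕ.suc-injective (trans (sym (count-drop f fi)) c₃)

  a₁ : Fin (suc (suc m))
  a₁ = proj₁ (count-pos⁻ (f ∘ punchIn i) (subst (1 ≤_) (sym c₂) (s≤s z≤n)))
  fa₁ : f (punchIn i a₁) ≡ true
  fa₁ = proj₂ (count-pos⁻ (f ∘ punchIn i) (subst (1 ≤_) (sym c₂) (s≤s z≤n)))

  c₁ : count (f ∘ punchIn i ∘ punchIn a₁) ≡ 1
  c₁ = ℕ.suc-injective (trans (sym (count-drop (f ∘ punchIn i) fa₁)) c₂)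

  b₁ : Fin (suc m)
  b₁ = proj₁ (count-pos⁻ (f ∘ punchIn i ∘ punchIn a₁) (subst (1 ≤_) (sym c₁) (s≤s z≤n)))
  fb₁ : f (punchIn i (punchIn a₁ b₁)) ≡ true
  fb₁ = proj₂ (count-pos⁻ (f ∘ punchIn i ∘ punchIn a₁) (subst (1 ≤_) (sym c₁) (s≤s z≤n)))

  only : ∀ y → f y ≡ true → y ≡ i ⊎ y ≡ punchIn i a₁ ⊎ y ≡ punchIn i (punchIn a₁ b₁)
  only y fy with punchIn-view i y
  ... | inj₁ y≡i = inj₁ y≡i
  ... | inj₂ (y₁ , refl) with punchIn-view a₁ y₁
  ... | inj₁ refl = inj₂ (inj₁ refl)
  ... | inj₂ (y₂ , refl) =
    inj₂ (inj₂ (cong (punchIn i ∘ punchIn a₁)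
                     (count≤1⇒unique (f ∘ punchIn i ∘ punchIn a₁) (ℕ.≤-reflexive c₁) fy fb₁)))

-- Trees

removeEdge⁺ : ∀ {m} (A : Rel₂ m) a b {x y} → A x y ≡ true →
              ¬ (x ≡ a × y ≡ b) → ¬ (x ≡ b × y ≡ a) → removeEdge A a b x y ≡ true
removeEdge⁺ A a b {x} {y} xy n₁ n₂ rewrite xy
  with x ≟ᶠ a | y ≟ᶠ b | x ≟ᶠ b | y ≟ᶠ a
... | yes p | yes q | _     | _     = ⊥-elim (n₁ (p , q))
... | _     | _     | yes p | yes q = ⊥-elim (n₂ (p , q))
... | yes _ | no _  | yes _ | no _  = refl
... | yes _ | no _  | no _  | _     = refl
... | no _  | _     | yes _ | no _  = refl
... | no _  | _     | no _  | _     = refl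

removeEdge⁻ : ∀ {m} (A : Rel₂ m) a b {x y} → removeEdge A a b x y ≡ true →
              A x y ≡ true × ¬ (x ≡ a × y ≡ b) × ¬ (x ≡ b × y ≡ a)
removeEdge⁻ A a b {x} {y} e
  with A x y | x ≟ᶠ a | y ≟ᶠ b | x ≟ᶠ b | y ≟ᶠ a
... | true | yes _ | no y≢b | yes _ | no y≢a =
  refl , (λ (_ , q) → y≢b q) , (λ (_ , q) → y≢a q)
... | true | yes _ | no y≢b | no x≢b | _ =
  refl , (λ (_ , q) → y≢b q) , (λ (p , _) → x≢b p)
... | true | no x≢a | _ | yes _ | no y≢a =
  refl , (λ (p , _) → x≢a p) , (λ (_ , q) → y≢a q)
... | true | no x≢a | _ | no x≢b | _ =
  refl , (λ (p , _) → x≢a p) , (λ (p , _) → x≢b p)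

removeEdge⇒adj : ∀ {m} (A : Rel₂ m) a b {x y} → removeEdge A a b x y ≡ true → A x y ≡ true
removeEdge⇒adj A a b = proj₁ ∘ removeEdge⁻ A a b

reach-single : ∀ {m} {R : Rel₂ m} {a b} → R a b ≡ true → Reach R a b
reach-single r = step r here

reach-≡ : ∀ {m} {R : Rel₂ m} {x y} → x ≡ y → Reach R x y
reach-≡ refl = here

reach-resp-≡ : ∀ {m} {R : Rel₂ m} {x y u v} → x ≡ u → y ≡ v → Reach R u v → Reach R x y
reach-resp-≡ refl refl w = w

reach-single-≡ : ∀ {m} {R : Rel₂ m} {x y u v} → x ≡ u → y ≡ v → R u v ≡ true → Reach R x y
reach-single-≡ x≡u y≡v r = reach-resp-≡ x≡u y≡v (reach-single r)

reach-trans : ∀ {m} {R : Rel₂ m} {a b c} → Reach R a b → Reach R b c → Reach R a c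
reach-trans here       w′ = w′
reach-trans (step r w) w′ = step r (reach-trans w w′)

reach-map : ∀ {m m′} {R : Rel₂ m} {R′ : Rel₂ m′} (σ : Fin m → Fin m′) →
            (∀ s t → R s t ≡ true → Reach R′ (σ s) (σ t)) →
            ∀ {x y} → Reach R x y → Reach R′ (σ x) (σ y)
reach-map σ sim here                 = here
reach-map σ sim (step {a} {b} r w) = reach-trans (sim a b r) (reach-map σ sim w)

EveryEdgeIsBridge : ∀ {m} → Rel₂ m → Set
EveryEdgeIsBridge A = ∀ x y → A x y ≡ true → ¬ Reach (removeEdge A x y) y x

data Path {m} (R : Rel₂ m) : Fin m → List (Fin m) → Fin m → Set where
  []  : ∀ {a} → Path R a [] a
  _∷_ : ∀ {a b vs c} → R a b ≡ true → Path R b vs c → Path R a (b ∷ vs) c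

Arcs : ∀ {m} → Rel₂ m → List (Fin m × Fin m) → Set
Arcs R = All (λ (x , y) → R x y ≡ true)

module _ {m} {R : Rel₂ m} where

  reach⇒simplePath : ∀ {a c} → Reach R a c → Σ (List (Fin m)) λ vs → Path R a vs c × Unique (a ∷ vs)
  reach⇒simplePath here = [] , [] , [] ∷ []
  reach⇒simplePath {a} (step {b = b} r w) with reach⇒simplePath w
  ... | vs , p , u with any? (a ≟ᶠ_) (b ∷ vs)
  ... | yes a∈ = suffix p a∈ u
    where
    suffix : ∀ {b vs c} → Path R b vs c → a ∈ (b ∷ vs) → Unique (b ∷ vs) →
             Σ (List (Fin m)) λ vs′ → Path R a vs′ c × Unique (a ∷ vs′)
    suffix p        (here refl) u       = _ , p , u
    suffix (_ ∷ p) (there a∈)  (_ ∷ u) = suffix p a∈ u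
  ... | no a∉ = b ∷ vs , r ∷ p , All.¬Any⇒All¬ _ a∉ ∷ u

  path+arc⇒closedWalk : ∀ {a vs c e} → Path R a vs c → R c e ≡ true →
                        Arcs R (pathPairs a vs e)
  path+arc⇒closedWalk []      ce = ce ∷ []
  path+arc⇒closedWalk (r ∷ p) ce = r ∷ path+arc⇒closedWalk p ce

  arcs⇒reach : ∀ a vs e → Arcs R (pathPairs a vs e) → Reach R a e
  arcs⇒reach a []       e (r ∷ []) = reach-single r
  arcs⇒reach a (b ∷ vs) e (r ∷ rs) = step r (arcs⇒reach b vs e rs)

acyclic⇒everyEdgeIsBridge : ∀ {m} (A : Rel₂ m) → (∀ a → A a a ≡ false) →
                            (∀ vs → IsCycle A vs → length vs < 3) → EveryEdgeIsBridge A
acyclic⇒everyEdgeIsBridge A irr acyclic x y xy w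
  with reach⇒simplePath w
... | [] , [] , _ = true≢false (trans (sym xy) (irr x))
... | _ ∷ [] , r ∷ [] , _ = proj₂ (proj₂ (removeEdge⁻ A x y r)) (refl , refl)
... | b ∷ c ∷ vs , p , u =
  ℕ.<⇒≱ (acyclic (y ∷ b ∷ c ∷ vs)
           (nonEmpty , u , path+arc⇒closedWalk (mapPath p) xy))
        (s≤s (s≤s (s≤s z≤n)))
  where
  mapPath : ∀ {a vs c} → Path (removeEdge A x y) a vs c → Path A a vs c
  mapPath []      = []
  mapPath (r ∷ p) = removeEdge⇒adj A x y r ∷ mapPath p

everyEdgeIsBridge⇒acyclic : ∀ {m} (A : Rel₂ m) → EveryEdgeIsBridge A →
                            ∀ vs → IsCycle A vs → length vs < 3
everyEdgeIsBridge⇒acyclic A bridges []               _ = s≤s z≤n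
everyEdgeIsBridge⇒acyclic A bridges (_ ∷ [])         _ = s≤s (s≤s z≤n)
everyEdgeIsBridge⇒acyclic A bridges (_ ∷ _ ∷ [])     _ = s≤s (s≤s (s≤s z≤n))
everyEdgeIsBridge⇒acyclic A bridges (v₀ ∷ v₁ ∷ v₂ ∷ vs)
  (_ , ((v₀∉v₁ ∷ v₀∉v₂ ∷ v₀∉vs) ∷ (v₁∉v₂ ∷ v₁∉vs) ∷ _) , (a₀₁ ∷ a₁₂ ∷ as)) =
  ⊥-elim (bridges v₀ v₁ a₀₁ (step first (arcs⇒reach v₂ vs v₀ (avoid v₂ vs as (v₀∉v₂ ∷ v₀∉vs) (v₁∉v₂ ∷ v₁∉vs)))))
  where
  first : removeEdge A v₀ v₁ v₁ v₂ ≡ true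
  first = removeEdge⁺ A v₀ v₁ a₁₂ (λ (e , _) → v₀∉v₁ (sym e)) (λ (_ , e) → v₀∉v₂ (sym e))

  avoiding : ∀ {s t} → A s t ≡ true → v₀ ≢ s → v₁ ≢ s → removeEdge A v₀ v₁ s t ≡ true
  avoiding r s≢v₀ s≢v₁ = removeEdge⁺ A v₀ v₁ r (λ (e , _) → s≢v₀ (sym e)) (λ (e , _) → s≢v₁ (sym e))

  avoid : ∀ s ws → Arcs A (pathPairs s ws v₀) → All (v₀ ≢_) (s ∷ ws) → All (v₁ ≢_) (s ∷ ws) →
          Arcs (removeEdge A v₀ v₁) (pathPairs s ws v₀)
  avoid s []       (r ∷ [])  (n₀ ∷ [])  (n₁ ∷ [])  = avoiding r n₀ n₁ ∷ []
  avoid s (w ∷ ws) (r ∷ rs) (n₀ ∷ ns₀) (n₁ ∷ ns₁) = avoiding r n₀ n₁ ∷ avoid w ws rs ns₀ ns₁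

-- Restricting leaf-labelled cubic trees

leaf-≡ : ∀ {T : CubicTree} {x y : Fin (m T)} {dx : degree (adj T) x ≤ 1} {dy : degree (adj T) y ≤ 1} →
         x ≡ y → _≡_ {A = Leaf T} (x , dx) (y , dy)
leaf-≡ refl = cong (_ ,_) (ℕ.≤-irrelevant _ _)

Side : (T : CubicTree) {N : ℕ} → Leaf T ↔ Fin N → Fin (m T) → Fin (m T) → Fin N → Set
Side T φ c d v = Reach (removeEdge (adj T) c d) c (proj₁ (Inverse.from φ v))

record Restriction (T : CubicTree) {N : ℕ} (φ : Leaf T ↔ Fin N) {N′ : ℕ} (g : Fin N′ → Fin N) : Set where
  field
    subtree    : CubicTree
    labelling  : Leaf subtree ↔ Fin N′
    edge-image : ∀ x y → adj subtree x y ≡ true → Σ (Fin (m T)) λ c → Σ (Fin (m T)) λ d →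
                 adj T c d ≡ true × (∀ v → Side subtree labelling x y v ⇔ Side T φ c d (g v))

-- Fin M as the complement of two distinct points ℓ and p of Fin (2 + M)
module SkipTwo {M : ℕ} (ℓ p : Fin (suc (suc M))) (ℓ≢p : ℓ ≢ p) where

  p̂ : Fin (suc M)
  p̂ = punchOut ℓ≢p

  inc : Fin M → Fin (suc (suc M))
  inc x = punchIn ℓ (punchIn p̂ x)

  inc-injective : ∀ {x y} → inc x ≡ inc y → x ≡ y
  inc-injective e = punchIn-injective p̂ _ _ (punchIn-injective ℓ _ _ e)

  inc≢ℓ : ∀ x → inc x ≢ ℓ
  inc≢ℓ x = punchInᵢ≢i ℓ _

  inc≢p : ∀ x → inc x ≢ p
  inc≢p x e = punchInᵢ≢i p̂ x (punchIn-injective ℓ _ _ (trans e (sym (punchIn-punchOut ℓ≢p))))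

  inc⁻¹ : ∀ y → y ≢ ℓ → y ≢ p → ∃ λ x → inc x ≡ y
  inc⁻¹ y y≢ℓ y≢p = punchOut p̂≢ŷ , trans (cong (punchIn ℓ) (punchIn-punchOut p̂≢ŷ)) (punchIn-punchOut ℓ≢y)
    where
    ℓ≢y : ℓ ≢ y
    ℓ≢y e = y≢ℓ (sym e)
    p̂≢ŷ : p̂ ≢ punchOut ℓ≢y
    p̂≢ŷ e = y≢p (trans (sym (punchIn-punchOut ℓ≢y))
                  (trans (cong (punchIn ℓ) (sym e)) (punchIn-punchOut ℓ≢p)))

-- Deleting a leaf ℓ of a cubic tree and suppressing its neighbour p,
-- whose other two neighbours a and b become adjacent.
module LeafDeletion
  (M : ℕ) (A : Rel₂ (suc (suc M)))
  (A-sym : ∀ x y → A x y ≡ A y x) (A-irrefl : ∀ x → A x x ≡ false)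
  (A-connected : ∀ x y → Reach A x y) (A-acyclic : ∀ vs → IsCycle A vs → length vs < 3)
  (A-cubic : ∀ x → degree A x ≤ 1 ⊎ degree A x ≡ 3)
  (ℓ p a b : Fin (suc (suc M)))
  (ℓp : A ℓ p ≡ true) (ℓ-pendant : ∀ y → A ℓ y ≡ true → y ≡ p)
  (pa : A p a ≡ true) (pb : A p b ≡ true) (a≢b : a ≢ b) (a≢ℓ : a ≢ ℓ) (b≢ℓ : b ≢ ℓ)
  (p-nbrs : ∀ y → A p y ≡ true → y ≡ ℓ ⊎ y ≡ a ⊎ y ≡ b)
  where

  V : Set
  V = Fin (suc (suc M))

  T : CubicTree
  T = record { m = suc (suc M) ; adj = A ; symmetric = A-sym ; irrefl = A-irrefl
             ; connected = A-connected ; acyclic = A-acyclic ; cubic = A-cubic }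

  A-bridges : EveryEdgeIsBridge A
  A-bridges = acyclic⇒everyEdgeIsBridge A A-irrefl A-acyclic

  adj-sym : ∀ {x y} → A x y ≡ true → A y x ≡ true
  adj-sym {x} {y} e = trans (A-sym y x) e

  adj⇒≢ : ∀ {x y} → A x y ≡ true → x ≢ y
  adj⇒≢ {x} e refl = true≢false (trans (sym e) (A-irrefl x))

  adj-false : ∀ {x y} → A x y ≡ true → A x y ≡ false → ⊥
  adj-false e f = true≢false (trans (sym e) f)

  ℓ≢p : ℓ ≢ p
  ℓ≢p = adj⇒≢ ℓp

  a≢p : a ≢ p
  a≢p e = adj⇒≢ pa (sym e)

  b≢p : b ≢ p
  b≢p e = adj⇒≢ pb (sym e)

  open SkipTwo ℓ p ℓ≢p

  collapse : Fin M → V → Fin M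
  collapse q y with y ≟ᶠ ℓ | y ≟ᶠ p
  ... | yes _   | _       = q
  ... | no _    | yes _   = q
  ... | no y≢ℓ | no y≢p = proj₁ (inc⁻¹ y y≢ℓ y≢p)

  inc-collapse : ∀ q y → y ≢ ℓ → y ≢ p → inc (collapse q y) ≡ y
  inc-collapse q y y≢ℓ y≢p with y ≟ᶠ ℓ | y ≟ᶠ p
  ... | yes e   | _       = ⊥-elim (y≢ℓ e)
  ... | no _    | yes e   = ⊥-elim (y≢p e)
  ... | no y≢ℓ | no y≢p = proj₂ (inc⁻¹ y y≢ℓ y≢p)

  collapse-ℓ : ∀ q → collapse q ℓ ≡ q
  collapse-ℓ q with ℓ ≟ᶠ ℓ
  ... | yes _ = refl
  ... | no n  = ⊥-elim (n refl)

  collapse-p : ∀ q → collapse q p ≡ q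
  collapse-p q with p ≟ᶠ ℓ | p ≟ᶠ p
  ... | yes _ | _     = refl
  ... | no _  | yes _ = refl
  ... | no _  | no n  = ⊥-elim (n refl)

  collapse-inc : ∀ q x → collapse q (inc x) ≡ x
  collapse-inc q x = inc-injective (inc-collapse q (inc x) (inc≢ℓ x) (inc≢p x))

  collapse-irrelevant : ∀ q r y → y ≢ ℓ → y ≢ p → collapse q y ≡ collapse r y
  collapse-irrelevant q r y y≢ℓ y≢p =
    inc-injective (trans (inc-collapse q y y≢ℓ y≢p) (sym (inc-collapse r y y≢ℓ y≢p)))

  abstract
    a′ b′ : Fin M
    a′ = proj₁ (inc⁻¹ a a≢ℓ a≢p)
    b′ = proj₁ (inc⁻¹ b b≢ℓ b≢p)

    inc-a′ : inc a′ ≡ a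
    inc-a′ = proj₂ (inc⁻¹ a a≢ℓ a≢p)

    inc-b′ : inc b′ ≡ b
    inc-b′ = proj₂ (inc⁻¹ b b≢ℓ b≢p)

  a′≢b′ : a′ ≢ b′
  a′≢b′ e = a≢b (trans (sym inc-a′) (trans (cong inc e) inc-b′))

  collapse-a : ∀ q → collapse q a ≡ a′
  collapse-a q = inc-injective (trans (inc-collapse q a a≢ℓ a≢p) (sym inc-a′))

  collapse-b : ∀ q → collapse q b ≡ b′
  collapse-b q = inc-injective (trans (inc-collapse q b b≢ℓ b≢p) (sym inc-b′))

  -- a and b are not adjacent, since a p b would otherwise close a triangle
  A-ab : A a b ≡ false
  A-ab with A a b in ab
  ... | false = refl
  ... | true  = ⊥-elim (A-bridges a p (adj-sym pa) (step p→b (reach-single b→a)))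
    where
    p→b : removeEdge A a p p b ≡ true
    p→b = removeEdge⁺ A a p pb (λ (e , _) → a≢p (sym e)) (λ (_ , e) → a≢b (sym e))
    b→a : removeEdge A a p b a ≡ true
    b→a = removeEdge⁺ A a p (adj-sym ab) (λ (e , _) → a≢b (sym e)) (λ (e , _) → b≢p e)

  A-ba : A b a ≡ false
  A-ba = trans (A-sym b a) A-ab

  -- The new tree: the induced tree on V ∖ {ℓ , p} plus the edge a′ b′.

  A′ : Rel₂ M
  A′ x y = A (inc x) (inc y) ∨ ((x == a′ ∧ y == b′) ∨ (x == b′ ∧ y == a′))

  A′-old : ∀ {x y} → A (inc x) (inc y) ≡ true → A′ x y ≡ true
  A′-old e rewrite e = refl

  A′-a′b′ : A′ a′ b′ ≡ true
  A′-a′b′ rewrite ==-refl a′ | ==-refl b′ = ∨-zeroʳ _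

  A′-b′a′ : A′ b′ a′ ≡ true
  A′-b′a′ rewrite ==-refl a′ | ==-refl b′ | ==-≢ a′≢b′ | ==-≢ (a′≢b′ ∘ sym) = ∨-zeroʳ _

  A-inc-a′b′ : A (inc a′) (inc b′) ≡ false
  A-inc-a′b′ = subst₂ (λ u v → A u v ≡ false) (sym inc-a′) (sym inc-b′) A-ab

  A-inc-b′a′ : A (inc b′) (inc a′) ≡ false
  A-inc-b′a′ = subst₂ (λ u v → A u v ≡ false) (sym inc-b′) (sym inc-a′) A-ba

  data A′-Edge (x y : Fin M) : Set where
    new  : x ≡ a′ → y ≡ b′ → A′-Edge x y
    new⁻ : x ≡ b′ → y ≡ a′ → A′-Edge x y
    old  : A (inc x) (inc y) ≡ true → ¬ (x ≡ a′ × y ≡ b′) → ¬ (x ≡ b′ × y ≡ a′) → A′-Edge x y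

  A′-edge : ∀ x y → A′ x y ≡ true → A′-Edge x y
  A′-edge x y e with A (inc x) (inc y) in old-xy
  ... | true = old old-xy (λ { (refl , refl) → adj-false old-xy A-inc-a′b′ })
                          (λ { (refl , refl) → adj-false old-xy A-inc-b′a′ })
  ... | false with x ≟ᶠ a′ | y ≟ᶠ b′ | x ≟ᶠ b′ | y ≟ᶠ a′
  ... | yes x≡a′ | yes y≡b′ | _        | _        = new x≡a′ y≡b′
  ... | _        | _        | yes x≡b′ | yes y≡a′ = new⁻ x≡b′ y≡a′
  A′-edge x y () | false | yes _ | no _ | yes _ | no _
  A′-edge x y () | false | yes _ | no _ | no _  | _
  A′-edge x y () | false | no _  | _    | yes _ | no _
  A′-edge x y () | false | no _  | _    | no _  | _

  A′-sym : ∀ x y → A′ x y ≡ A′ y x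
  A′-sym x y = cong₂ _∨_ (A-sym _ _)
    (trans (∨-comm (x == a′ ∧ y == b′) (x == b′ ∧ y == a′))
           (cong₂ _∨_ (∧-comm (x == b′) (y == a′)) (∧-comm (x == a′) (y == b′))))

  A′-irrefl : ∀ x → A′ x x ≡ false
  A′-irrefl x rewrite A-irrefl (inc x) with x ≟ᶠ a′ | x ≟ᶠ b′
  ... | yes x≡a′ | yes x≡b′ = ⊥-elim (a′≢b′ (trans (sym x≡a′) x≡b′))
  ... | yes _    | no _     = refl
  ... | no _     | yes _    = refl
  ... | no _     | no _     = refl

  A-inc-ℓ : ∀ x → A (inc x) ℓ ≡ false
  A-inc-ℓ x with A (inc x) ℓ in e
  ... | false = refl
  ... | true  = ⊥-elim (inc≢p x (ℓ-pendant _ (adj-sym e)))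

  A-inc-p : ∀ x → x ≢ a′ → x ≢ b′ → A (inc x) p ≡ false
  A-inc-p x x≢a′ x≢b′ with A (inc x) p in e
  ... | false = refl
  ... | true with p-nbrs (inc x) (adj-sym e)
  ... | inj₁ e′        = ⊥-elim (inc≢ℓ x e′)
  ... | inj₂ (inj₁ e′) = ⊥-elim (x≢a′ (inc-injective (trans e′ (sym inc-a′))))
  ... | inj₂ (inj₂ e′) = ⊥-elim (x≢b′ (inc-injective (trans e′ (sym inc-b′))))

  A-inc-a′-p : A (inc a′) p ≡ true
  A-inc-a′-p = trans (cong (λ u → A u p) inc-a′) (adj-sym pa)

  A-inc-b′-p : A (inc b′) p ≡ true
  A-inc-b′-p = trans (cong (λ u → A u p) inc-b′) (adj-sym pb)

  count-A-inc : ∀ x → count (A (inc x)) ≡ bit (A (inc x) p) + count (A (inc x) ∘ inc)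
  count-A-inc x = begin
    count (A (inc x))
      ≡⟨ count-punchIn (A (inc x)) ℓ ⟩
    bit (A (inc x) ℓ) + count (A (inc x) ∘ punchIn ℓ)
      ≡⟨ cong (λ β → bit β + count (A (inc x) ∘ punchIn ℓ)) (A-inc-ℓ x) ⟩
    count (A (inc x) ∘ punchIn ℓ)
      ≡⟨ count-punchIn (A (inc x) ∘ punchIn ℓ) p̂ ⟩
    bit (A (inc x) (punchIn ℓ p̂)) + count (A (inc x) ∘ inc)
      ≡⟨ cong (λ u → bit (A (inc x) u) + count (A (inc x) ∘ inc)) (punchIn-punchOut ℓ≢p) ⟩
    bit (A (inc x) p) + count (A (inc x) ∘ inc) ∎
    where open ≡-Reasoning

  A′-from-a′ : ∀ y → A′ a′ y ≡ A (inc a′) (inc y) ∨ (y == b′)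
  A′-from-a′ y rewrite ==-refl a′ | ==-≢ a′≢b′ = cong (A (inc a′) (inc y) ∨_) (∨-identityʳ _)

  A′-from-b′ : ∀ y → A′ b′ y ≡ A (inc b′) (inc y) ∨ (y == a′)
  A′-from-b′ y rewrite ==-refl b′ | ==-≢ (a′≢b′ ∘ sym) = refl

  A′-from-other : ∀ x y → x ≢ a′ → x ≢ b′ → A′ x y ≡ A (inc x) (inc y)
  A′-from-other x y x≢a′ x≢b′ rewrite ==-≢ x≢a′ | ==-≢ x≢b′ = ∨-identityʳ _

  -- a′ and b′ trade their neighbour p for each other
  count-A′ : ∀ x → count (A′ x) ≡ bit (A (inc x) p) + count (A (inc x) ∘ inc)
  count-A′ x = by-cases x (x ≟ᶠ a′) (x ≟ᶠ b′)
    where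
    by-cases : ∀ x → Dec (x ≡ a′) → Dec (x ≡ b′) →
               count (A′ x) ≡ bit (A (inc x) p) + count (A (inc x) ∘ inc)
    by-cases x (yes refl) _ rewrite A-inc-a′-p =
      trans (count-cong A′-from-a′) (count-∨-single (A (inc a′) ∘ inc) b′ A-inc-a′b′)
    by-cases x (no _) (yes refl) rewrite A-inc-b′-p =
      trans (count-cong A′-from-b′) (count-∨-single (A (inc b′) ∘ inc) a′ A-inc-b′a′)
    by-cases x (no x≢a′) (no x≢b′) rewrite A-inc-p x x≢a′ x≢b′ =
      count-cong (λ y → A′-from-other x y x≢a′ x≢b′)

  degree-A′ : ∀ x → degree A′ x ≡ degree A (inc x)
  degree-A′ x = begin
    degree A′ x                                  ≡⟨ degree≡count A′ x ⟩
    count (A′ x)                                 ≡⟨ count-A′ x ⟩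
    bit (A (inc x) p) + count (A (inc x) ∘ inc)  ≡⟨ count-A-inc x ⟨
    count (A (inc x))                            ≡⟨ degree≡count A (inc x) ⟨
    degree A (inc x)                             ∎
    where open ≡-Reasoning

  data A-Edge (q : Fin M) (s t : V) : Set where
    collapsed : collapse q s ≡ collapse q t → A-Edge q s t
    surviving : s ≢ ℓ → s ≢ p → t ≢ ℓ → t ≢ p → A-Edge q s t
    pa-edge   : (s ≡ p × t ≡ a) ⊎ (s ≡ a × t ≡ p) → A-Edge q s t
    pb-edge   : (s ≡ p × t ≡ b) ⊎ (s ≡ b × t ≡ p) → A-Edge q s t

  A-edge : ∀ q s t → A s t ≡ true → A-Edge q s t
  A-edge q s t st with s ≟ᶠ ℓ | s ≟ᶠ p | t ≟ᶠ ℓ | t ≟ᶠ p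
  ... | yes refl | _ | _ | _ =
    collapsed (trans (collapse-ℓ q) (sym (trans (cong (collapse q) (ℓ-pendant t st)) (collapse-p q))))
  ... | no _ | yes refl | _ | _ with p-nbrs t st
  ...   | inj₁ refl        = collapsed (trans (collapse-p q) (sym (collapse-ℓ q)))
  ...   | inj₂ (inj₁ refl) = pa-edge (inj₁ (refl , refl))
  ...   | inj₂ (inj₂ refl) = pb-edge (inj₁ (refl , refl))
  A-edge q s t st | no s≢ℓ | no s≢p | yes refl | _ = ⊥-elim (s≢p (ℓ-pendant s (adj-sym st)))
  A-edge q s t st | no s≢ℓ | no s≢p | no _ | yes refl with p-nbrs s (adj-sym st)
  ...   | inj₁ s≡ℓ         = ⊥-elim (s≢ℓ s≡ℓ)
  ...   | inj₂ (inj₁ refl) = pa-edge (inj₂ (refl , refl))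
  ...   | inj₂ (inj₂ refl) = pb-edge (inj₂ (refl , refl))
  A-edge q s t st | no s≢ℓ | no s≢p | no t≢ℓ | no t≢p = surviving s≢ℓ s≢p t≢ℓ t≢p

  surviving-edge : ∀ q {s t} → A s t ≡ true → s ≢ ℓ → s ≢ p → t ≢ ℓ → t ≢ p →
                   A′ (collapse q s) (collapse q t) ≡ true
  surviving-edge q st s≢ℓ s≢p t≢ℓ t≢p =
    A′-old (subst₂ (λ u v → A u v ≡ true) (sym (inc-collapse q _ s≢ℓ s≢p)) (sym (inc-collapse q _ t≢ℓ t≢p)) st)

  surviving-edge-avoids : ∀ q c′ d′ {s t} → A s t ≡ true → s ≢ ℓ → s ≢ p → t ≢ ℓ → t ≢ p →
                          ¬ (s ≡ inc c′ × t ≡ inc d′) → ¬ (s ≡ inc d′ × t ≡ inc c′) →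
                          removeEdge A′ c′ d′ (collapse q s) (collapse q t) ≡ true
  surviving-edge-avoids q c′ d′ st s≢ℓ s≢p t≢ℓ t≢p n₁ n₂ =
    removeEdge⁺ A′ c′ d′ (surviving-edge q st s≢ℓ s≢p t≢ℓ t≢p)
      (λ (e₁ , e₂) → n₁ (back s≢ℓ s≢p e₁ , back t≢ℓ t≢p e₂))
      (λ (e₁ , e₂) → n₂ (back s≢ℓ s≢p e₁ , back t≢ℓ t≢p e₂))
    where
    back : ∀ {u x} → u ≢ ℓ → u ≢ p → collapse q u ≡ x → u ≡ inc x
    back u≢ℓ u≢p e = trans (sym (inc-collapse q _ u≢ℓ u≢p)) (cong inc e)

  non-edge-avoided : ∀ {s t u v} → A s t ≡ true → A u v ≡ false → ¬ (s ≡ u × t ≡ v)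
  non-edge-avoided st uv (refl , refl) = adj-false st uv

  collapse-walk : ∀ s t → A s t ≡ true → Reach A′ (collapse a′ s) (collapse a′ t)
  collapse-walk s t st with A-edge a′ s t st
  ... | collapsed e                  = reach-≡ e
  ... | surviving s≢ℓ s≢p t≢ℓ t≢p   = reach-single (surviving-edge a′ st s≢ℓ s≢p t≢ℓ t≢p)
  ... | pa-edge (inj₁ (refl , refl)) = reach-≡ (trans (collapse-p a′) (sym (collapse-a a′)))
  ... | pa-edge (inj₂ (refl , refl)) = reach-≡ (trans (collapse-a a′) (sym (collapse-p a′)))
  ... | pb-edge (inj₁ (refl , refl)) = reach-single-≡ (collapse-p a′) (collapse-b a′) A′-a′b′
  ... | pb-edge (inj₂ (refl , refl)) = reach-single-≡ (collapse-b a′) (collapse-p a′) A′-b′a′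

  A′-connected : ∀ x y → Reach A′ x y
  A′-connected x y = subst₂ (Reach A′) (collapse-inc a′ x) (collapse-inc a′ y)
                       (reach-map (collapse a′) collapse-walk (A-connected (inc x) (inc y)))

  collapse-walk-avoiding-old : ∀ c′ d′ → ¬ (c′ ≡ a′ × d′ ≡ b′) → ¬ (c′ ≡ b′ × d′ ≡ a′) →
    ∀ s t → removeEdge A (inc c′) (inc d′) s t ≡ true →
    Reach (removeEdge A′ c′ d′) (collapse a′ s) (collapse a′ t)
  collapse-walk-avoiding-old c′ d′ n₁ n₂ s t r with removeEdge⁻ A (inc c′) (inc d′) r
  ... | st , m₁ , m₂ with A-edge a′ s t st
  ... | collapsed e                  = reach-≡ e
  ... | surviving s≢ℓ s≢p t≢ℓ t≢p   = reach-single (surviving-edge-avoids a′ c′ d′ st s≢ℓ s≢p t≢ℓ t≢p m₁ m₂)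
  ... | pa-edge (inj₁ (refl , refl)) = reach-≡ (trans (collapse-p a′) (sym (collapse-a a′)))
  ... | pa-edge (inj₂ (refl , refl)) = reach-≡ (trans (collapse-a a′) (sym (collapse-p a′)))
  ... | pb-edge (inj₁ (refl , refl)) = reach-single-≡ (collapse-p a′) (collapse-b a′)
          (removeEdge⁺ A′ c′ d′ A′-a′b′ (λ (e₁ , e₂) → n₁ (sym e₁ , sym e₂)) (λ (e₁ , e₂) → n₂ (sym e₂ , sym e₁)))
  ... | pb-edge (inj₂ (refl , refl)) = reach-single-≡ (collapse-b a′) (collapse-p a′)
          (removeEdge⁺ A′ c′ d′ A′-b′a′ (λ (e₁ , e₂) → n₂ (sym e₁ , sym e₂)) (λ (e₁ , e₂) → n₁ (sym e₂ , sym e₁)))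

  collapse-walk-avoiding-ap : ∀ s t → removeEdge A a p s t ≡ true →
    Reach (removeEdge A′ a′ b′) (collapse b′ s) (collapse b′ t)
  collapse-walk-avoiding-ap s t r with removeEdge⁻ A a p r
  ... | st , m₁ , m₂ with A-edge b′ s t st
  ... | collapsed e                  = reach-≡ e
  ... | surviving s≢ℓ s≢p t≢ℓ t≢p   = reach-single (surviving-edge-avoids b′ a′ b′ st s≢ℓ s≢p t≢ℓ t≢p
                                         (non-edge-avoided st A-inc-a′b′) (non-edge-avoided st A-inc-b′a′))
  ... | pa-edge (inj₁ (refl , refl)) = ⊥-elim (m₂ (refl , refl))
  ... | pa-edge (inj₂ (refl , refl)) = ⊥-elim (m₁ (refl , refl))
  ... | pb-edge (inj₁ (refl , refl)) = reach-≡ (trans (collapse-p b′) (sym (collapse-b b′)))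
  ... | pb-edge (inj₂ (refl , refl)) = reach-≡ (trans (collapse-b b′) (sym (collapse-p b′)))

  collapse-walk-avoiding-bp : ∀ s t → removeEdge A b p s t ≡ true →
    Reach (removeEdge A′ b′ a′) (collapse a′ s) (collapse a′ t)
  collapse-walk-avoiding-bp s t r with removeEdge⁻ A b p r
  ... | st , m₁ , m₂ with A-edge a′ s t st
  ... | collapsed e                  = reach-≡ e
  ... | surviving s≢ℓ s≢p t≢ℓ t≢p   = reach-single (surviving-edge-avoids a′ b′ a′ st s≢ℓ s≢p t≢ℓ t≢p
                                         (non-edge-avoided st A-inc-b′a′) (non-edge-avoided st A-inc-a′b′))
  ... | pa-edge (inj₁ (refl , refl)) = reach-≡ (trans (collapse-p a′) (sym (collapse-a a′)))
  ... | pa-edge (inj₂ (refl , refl)) = reach-≡ (trans (collapse-a a′) (sym (collapse-p a′)))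
  ... | pb-edge (inj₁ (refl , refl)) = ⊥-elim (m₂ (refl , refl))
  ... | pb-edge (inj₂ (refl , refl)) = ⊥-elim (m₁ (refl , refl))

  -- the new edge a′ b′ stands for the path a p b

  through-p-avoiding : ∀ {c′ d′ y y′} → A p y ≡ true → A p y′ ≡ true →
                       Reach (removeEdge A (inc c′) (inc d′)) y y′
  through-p-avoiding {c′} {d′} py py′ =
    step (removeEdge⁺ A _ _ (adj-sym py) (λ (_ , e) → inc≢p d′ (sym e)) (λ (_ , e) → inc≢p c′ (sym e)))
         (reach-single (removeEdge⁺ A _ _ py′ (λ (e , _) → inc≢p c′ (sym e)) (λ (e , _) → inc≢p d′ (sym e))))

  inc-walk-avoiding : ∀ c′ d′ s t → removeEdge A′ c′ d′ s t ≡ true →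
    Reach (removeEdge A (inc c′) (inc d′)) (inc s) (inc t)
  inc-walk-avoiding c′ d′ s t r with removeEdge⁻ A′ c′ d′ r
  ... | st , m₁ , m₂ with A′-edge s t st
  ... | new refl refl  = reach-resp-≡ inc-a′ inc-b′ (through-p-avoiding pa pb)
  ... | new⁻ refl refl = reach-resp-≡ inc-b′ inc-a′ (through-p-avoiding pb pa)
  ... | old st′ _ _ = reach-single (removeEdge⁺ A _ _ st′
          (λ (e₁ , e₂) → m₁ (inc-injective e₁ , inc-injective e₂))
          (λ (e₁ , e₂) → m₂ (inc-injective e₁ , inc-injective e₂)))

  IsNewEdge : Fin M → Fin M → Set
  IsNewEdge c′ d′ = (c′ ≡ a′ × d′ ≡ b′) ⊎ (c′ ≡ b′ × d′ ≡ a′)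

  inc-walk-avoiding-new : ∀ c′ d′ → IsNewEdge c′ d′ → ∀ s t → removeEdge A′ c′ d′ s t ≡ true →
    Reach (removeEdge A (inc c′) p) (inc s) (inc t)
  inc-walk-avoiding-new c′ d′ new? s t r with removeEdge⁻ A′ c′ d′ r
  ... | st , m₁ , m₂ with A′-edge s t st | new?
  ... | new refl refl  | inj₁ (refl , refl) = ⊥-elim (m₁ (refl , refl))
  ... | new refl refl  | inj₂ (refl , refl) = ⊥-elim (m₂ (refl , refl))
  ... | new⁻ refl refl | inj₁ (refl , refl) = ⊥-elim (m₂ (refl , refl))
  ... | new⁻ refl refl | inj₂ (refl , refl) = ⊥-elim (m₁ (refl , refl))
  ... | old st′ _ _    | _ = reach-single (removeEdge⁺ A _ _ st′ (λ (_ , e) → inc≢p t e) (λ (e , _) → inc≢p s e))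

  A′-bridges : EveryEdgeIsBridge A′
  A′-bridges x y xy w with A′-edge x y xy
  ... | new refl refl =
    A-bridges a p (adj-sym pa) (step p→b (reach-resp-≡ (sym inc-b′) (sym inc-a′)
      (subst (λ u → Reach (removeEdge A u p) (inc b′) (inc a′)) inc-a′
        (reach-map inc (inc-walk-avoiding-new a′ b′ (inj₁ (refl , refl))) w))))
    where
    p→b : removeEdge A a p p b ≡ true
    p→b = removeEdge⁺ A a p pb (λ (e , _) → a≢p (sym e)) (λ (_ , e) → a≢b (sym e))
  ... | new⁻ refl refl =
    A-bridges b p (adj-sym pb) (step p→a (reach-resp-≡ (sym inc-a′) (sym inc-b′)
      (subst (λ u → Reach (removeEdge A u p) (inc a′) (inc b′)) inc-b′
        (reach-map inc (inc-walk-avoiding-new b′ a′ (inj₂ (refl , refl))) w))))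
    where
    p→a : removeEdge A b p p a ≡ true
    p→a = removeEdge⁺ A b p pa (λ (e , _) → b≢p (sym e)) (λ (_ , e) → a≢b e)
  ... | old st _ _ = A-bridges (inc x) (inc y) st (reach-map inc (inc-walk-avoiding x y) w)

  T′ : CubicTree
  T′ = record
    { m         = M
    ; adj       = A′
    ; symmetric = A′-sym
    ; irrefl    = A′-irrefl
    ; connected = A′-connected
    ; acyclic   = everyEdgeIsBridge⇒acyclic A′ A′-bridges
    ; cubic     = λ x → subst (λ k → k ≤ 1 ⊎ k ≡ 3) (sym (degree-A′ x)) (A-cubic (inc x))
    }

  edge-correspondence : ∀ x y → A′ x y ≡ true → Σ V λ c → Σ V λ d → A c d ≡ true ×
    (∀ z → z ≢ ℓ → z ≢ p → Reach (removeEdge A′ x y) x (collapse a′ z) ⇔ Reach (removeEdge A c d) c z)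
  edge-correspondence x y xy with A′-edge x y xy
  ... | new refl refl = a , p , adj-sym pa , λ z z≢ℓ z≢p → mk⇔
    (λ w → reach-resp-≡ (sym inc-a′) (sym (inc-collapse a′ z z≢ℓ z≢p))
             (subst (λ u → Reach (removeEdge A u p) (inc a′) (inc (collapse a′ z))) inc-a′
               (reach-map inc (inc-walk-avoiding-new a′ b′ (inj₁ (refl , refl))) w)))
    (λ w → subst₂ (Reach (removeEdge A′ a′ b′)) (collapse-a b′) (collapse-irrelevant b′ a′ z z≢ℓ z≢p)
             (reach-map (collapse b′) collapse-walk-avoiding-ap w))
  ... | new⁻ refl refl = b , p , adj-sym pb , λ z z≢ℓ z≢p → mk⇔
    (λ w → reach-resp-≡ (sym inc-b′) (sym (inc-collapse a′ z z≢ℓ z≢p))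
             (subst (λ u → Reach (removeEdge A u p) (inc b′) (inc (collapse a′ z))) inc-b′
               (reach-map inc (inc-walk-avoiding-new b′ a′ (inj₂ (refl , refl))) w)))
    (λ w → subst (λ u → Reach (removeEdge A′ b′ a′) u (collapse a′ z)) (collapse-b a′)
             (reach-map (collapse a′) collapse-walk-avoiding-bp w))
  ... | old xy′ n₁ n₂ = inc x , inc y , xy′ , λ z z≢ℓ z≢p → mk⇔
    (λ w → reach-resp-≡ refl (sym (inc-collapse a′ z z≢ℓ z≢p)) (reach-map inc (inc-walk-avoiding x y) w))
    (λ w → subst (λ u → Reach (removeEdge A′ x y) u (collapse a′ z)) (collapse-inc a′ x)
             (reach-map (collapse a′) (collapse-walk-avoiding-old x y n₁ n₂) w))

  p-not-leaf : ¬ degree A p ≤ 1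
  p-not-leaf d = a≢b (count≤1⇒unique (A p) (subst (_≤ 1) (degree≡count A p) d) pa pb)

  module _ {N : ℕ} (φ : Leaf T ↔ Fin (suc N)) (j : Fin (suc N)) (φj≡ℓ : proj₁ (Inverse.from φ j) ≡ ℓ) where
    open Inverse φ

    vertexOf : Fin N → V
    vertexOf i = proj₁ (from (punchIn j i))

    vertexOf≢ℓ : ∀ i → vertexOf i ≢ ℓ
    vertexOf≢ℓ i e = punchInᵢ≢i j i (trans (sym (strictlyInverseˡ _))
                       (trans (cong to (leaf-≡ {T} (trans e (sym φj≡ℓ)))) (strictlyInverseˡ j)))

    vertexOf≢p : ∀ i → vertexOf i ≢ p
    vertexOf≢p i e = p-not-leaf (subst (λ v → degree A v ≤ 1) e (proj₂ (from (punchIn j i))))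

    inc-collapse-vertexOf : ∀ i → inc (collapse a′ (vertexOf i)) ≡ vertexOf i
    inc-collapse-vertexOf i = inc-collapse a′ _ (vertexOf≢ℓ i) (vertexOf≢p i)

    asLeaf : Leaf T′ → Leaf T
    asLeaf (x , d) = inc x , subst (_≤ 1) (degree-A′ x) d

    j≢label : ∀ X → j ≢ to (asLeaf X)
    j≢label (x , _) e = inc≢ℓ x (trans (cong proj₁ (sym (trans (cong from e) (strictlyInverseʳ _)))) φj≡ℓ)

    labelling′ : Leaf T′ ↔ Fin N
    labelling′ = mk↔ₛ′ to′ from′ to′-from′ from′-to′
      where
      to′ : Leaf T′ → Fin N
      to′ X = punchOut (j≢label X)

      from′ : Fin N → Leaf T′
      from′ i = collapse a′ (vertexOf i) ,
                subst (_≤ 1) (sym (trans (degree-A′ _) (cong (degree A) (inc-collapse-vertexOf i))))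
                      (proj₂ (from (punchIn j i)))

      to′-from′ : ∀ i → to′ (from′ i) ≡ i
      to′-from′ i = trans (punchOut-cong j (trans (cong to (leaf-≡ {T} (inc-collapse-vertexOf i)))
                                                  (strictlyInverseˡ (punchIn j i))))
                          (punchOut-punchIn j)

      from′-to′ : ∀ X → from′ (to′ X) ≡ X
      from′-to′ (x , d) =
        leaf-≡ {T′} (trans (cong (collapse a′ ∘ proj₁)
                                 (trans (cong from (punchIn-punchOut (j≢label (x , d)))) (strictlyInverseʳ _)))
                           (collapse-inc a′ x))

    deletion : Restriction T φ (punchIn j)
    deletion = record
      { subtree    = T′
      ; labelling  = labelling′
      ; edge-image = λ x y xy →
          let c , d , cd , same = edge-correspondence x y xy
          in c , d , cd , λ v → same (vertexOf v) (vertexOf≢ℓ v) (vertexOf≢p v)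
      }

module LeafNeighbourhood {M : ℕ} (A : Rel₂ (suc (suc (suc M))))
  (A-sym : ∀ x y → A x y ≡ A y x) (A-irrefl : ∀ x → A x x ≡ false)
  (A-connected : ∀ x y → Reach A x y) (A-cubic : ∀ x → degree A x ≤ 1 ⊎ degree A x ≡ 3)
  (ℓ : Fin (suc (suc (suc M)))) (ℓ-leaf : degree A ℓ ≤ 1) where

  private
    first-step : ∀ {y} → Reach A ℓ y → y ≢ ℓ → ∃ λ q → A ℓ q ≡ true
    first-step here       y≢ℓ = ⊥-elim (y≢ℓ refl)
    first-step (step r _) _   = _ , r

    step-away : ∃ λ q → A ℓ q ≡ true
    step-away = first-step (A-connected ℓ (punchIn ℓ zero)) (punchInᵢ≢i ℓ zero)

  p : Fin (suc (suc (suc M)))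
  p = proj₁ step-away

  ℓp : A ℓ p ≡ true
  ℓp = proj₂ step-away

  ℓ-pendant : ∀ y → A ℓ y ≡ true → y ≡ p
  ℓ-pendant y ℓy = count≤1⇒unique (A ℓ) (subst (_≤ 1) (degree≡count A ℓ) ℓ-leaf) ℓy ℓp

  ℓ≢p : ℓ ≢ p
  ℓ≢p ℓ≡p = true≢false (trans (sym ℓp) (trans (cong (A ℓ) (sym ℓ≡p)) (A-irrefl ℓ)))

  -- if p were a leaf, {ℓ , p} would be a connected component
  p-not-leaf : ¬ degree A p ≤ 1
  p-not-leaf p-leaf = [ inc≢ℓ zero , inc≢p zero ] (stuck (A-connected ℓ (inc zero)) (inj₁ refl))
    where
    open SkipTwo ℓ p ℓ≢p
    p-pendant : ∀ y → A p y ≡ true → y ≡ ℓ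
    p-pendant y py = count≤1⇒unique (A p) (subst (_≤ 1) (degree≡count A p) p-leaf) py
                       (trans (A-sym p ℓ) ℓp)
    stuck : ∀ {s z} → Reach A s z → s ≡ ℓ ⊎ s ≡ p → z ≡ ℓ ⊎ z ≡ p
    stuck here       s∈ = s∈
    stuck (step r w) (inj₁ refl) = stuck w (inj₂ (ℓ-pendant _ r))
    stuck (step r w) (inj₂ refl) = stuck w (inj₁ (p-pendant _ r))

  otherTwo : OtherTwo (A p) ℓ
  otherTwo with A-cubic p
  ... | inj₁ p-leaf = ⊥-elim (p-not-leaf p-leaf)
  ... | inj₂ deg≡3  = count≡3⇒otherTwo (A p) (trans (A-sym p ℓ) ℓp) (trans (sym (degree≡count A p)) deg≡3)

deleteLeaf : ∀ (T : CubicTree) {N} (φ : Leaf T ↔ Fin (suc N)) (j : Fin (suc N)) → 3 ≤ m T →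
             Restriction T φ (punchIn j)
deleteLeaf T = go (m T) (adj T) (symmetric T) (irrefl T) (connected T) (acyclic T) (cubic T)
  where
  go : ∀ k A A-sym A-irrefl A-connected A-acyclic A-cubic →
       let T = record { m = k ; adj = A ; symmetric = A-sym ; irrefl = A-irrefl
                      ; connected = A-connected ; acyclic = A-acyclic ; cubic = A-cubic } in
       ∀ {N} (φ : Leaf T ↔ Fin (suc N)) (j : Fin (suc N)) → 3 ≤ k → Restriction T φ (punchIn j)
  go (suc (suc (suc M))) A A-sym A-irrefl A-connected A-acyclic A-cubic φ j (s≤s (s≤s (s≤s _))) =
    LeafDeletion.deletion (suc M) A A-sym A-irrefl A-connected A-acyclic A-cubic
      ℓ p a b ℓp ℓ-pendant fa fb a≢b a≢i b≢i only φ j refl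
    where
    ℓ : Fin (suc (suc (suc M)))
    ℓ = proj₁ (Inverse.from φ j)
    open LeafNeighbourhood A A-sym A-irrefl A-connected A-cubic ℓ (proj₂ (Inverse.from φ j))
    open OtherTwo otherTwo

module _ {T : CubicTree} {N : ℕ} {φ : Leaf T ↔ Fin N} where

  restriction-cong : ∀ {N′} {g g′ : Fin N′ → Fin N} → (∀ v → g v ≡ g′ v) →
                     Restriction T φ g → Restriction T φ g′
  restriction-cong g≗g′ R = record
    { subtree    = subtree
    ; labelling  = labelling
    ; edge-image = λ x y xy →
        let c , d , cd , same = edge-image x y xy
        in c , d , cd , λ v → subst (λ u → Side subtree labelling x y v ⇔ Side T φ c d u) (g≗g′ v) (same v)
    }
    where open Restriction R

  restriction-∘ : ∀ {N₁ N′} {h : Fin N₁ → Fin N} {g : Fin N′ → Fin N₁} →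
                  (R : Restriction T φ h) → Restriction (Restriction.subtree R) (Restriction.labelling R) g →
                  Restriction T φ (h ∘ g)
  restriction-∘ {g = g} R R′ = record
    { subtree    = R′.subtree
    ; labelling  = R′.labelling
    ; edge-image = λ x y xy →
        let c′ , d′ , c′d′ , same′ = R′.edge-image x y xy
            c , d , cd , same = R.edge-image c′ d′ c′d′
        in c , d , cd , λ v → same (g v) ⇔-∘ same′ v
    }
    where
    module R = Restriction R
    module R′ = Restriction R′

edgeless-leaf : ∀ k (x : Fin k) → degree (λ _ _ → false) x ≤ 1
edgeless-leaf k x = subst (_≤ 1) (sym (trans (degree≡count _ x) (count-const-false {k}))) z≤n

edgeless : ∀ k → k ≤ 1 → CubicTree
edgeless k k≤1 = record
  { m         = k
  ; adj       = λ _ _ → false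
  ; symmetric = λ _ _ → refl
  ; irrefl    = λ _ → refl
  ; connected = connected′ k≤1
  ; acyclic   = λ { [] _ → s≤s z≤n ; (_ ∷ []) (_ , _ , () ∷ _) ; (_ ∷ _ ∷ _) (_ , _ , () ∷ _) }
  ; cubic     = λ x → inj₁ (edgeless-leaf k x)
  }
  where
  connected′ : ∀ {k} → k ≤ 1 → (x y : Fin k) → Reach (λ _ _ → false) x y
  connected′ _ zero zero = here
  connected′ {suc zero} _ zero (suc ())
  connected′ {suc (suc _)} (s≤s ()) _ _

edgeless-restriction : ∀ {T : CubicTree} {N} {φ : Leaf T ↔ Fin N} {N′} (g : Fin N′ → Fin N) →
                       N′ ≤ 1 → Restriction T φ g
edgeless-restriction {N′ = N′} g N′≤1 = record
  { subtree    = edgeless N′ N′≤1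
  ; labelling  = mk↔ₛ′ proj₁ (λ x → x , edgeless-leaf N′ x) (λ _ → refl) (λ _ → leaf-≡ {edgeless N′ N′≤1} refl)
  ; edge-image = λ _ _ ()
  }

bijective-restriction : ∀ {T : CubicTree} {N} {φ : Leaf T ↔ Fin N} {N′} (g : Fin N′ → Fin N) →
                        Injective _≡_ _≡_ g → (∀ y → ∃ λ x → g x ≡ y) → Restriction T φ g
bijective-restriction {T} {φ = φ} g g-injective g-surjective = record
  { subtree    = T
  ; labelling  = mk↔ₛ′ (g⁻¹ ∘ to) (from ∘ g)
                   (λ v → g-injective (trans (proj₂ (g-surjective _)) (strictlyInverseˡ _)))
                   (λ L → trans (cong from (proj₂ (g-surjective _))) (strictlyInverseʳ L))
  ; edge-image = λ x y xy → x , y , xy , λ _ → mk⇔ id id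
  }
  where
  open Inverse φ
  g⁻¹ : Fin _ → Fin _
  g⁻¹ = proj₁ ∘ g-surjective

leafVertex-injective : ∀ (T : CubicTree) {N} (φ : Leaf T ↔ Fin N) → Injective _≡_ _≡_ (proj₁ ∘ Inverse.from φ)
leafVertex-injective T φ e =
  trans (sym (Inverse.strictlyInverseˡ φ _))
        (trans (cong (Inverse.to φ) (leaf-≡ {T} e)) (Inverse.strictlyInverseˡ φ _))

-- Induction on the number of leaves: delete one leaf outside the image of g at a time.
restrict : ∀ N (T : CubicTree) (φ : Leaf T ↔ Fin N) {N′} (g : Fin N′ → Fin N) → Injective _≡_ _≡_ g →
           Restriction T φ g
restrict N T φ {zero} g _ = edgeless-restriction g z≤n
restrict N T φ {suc zero} g _ = edgeless-restriction g (s≤s z≤n)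
restrict N T φ {suc (suc N′)} g g-injective with allᶠ? (λ y → anyᶠ? (λ x → g x ≟ᶠ y))
... | yes g-surjective = bijective-restriction g g-injective g-surjective
restrict zero T φ {suc (suc N′)} g g-injective | no _ with () ← g zero
restrict (suc N) T φ {suc (suc N′)} g g-injective | no g-not-surjective =
  restriction-cong (λ x → punchIn-punchOut (j∉g x))
    (restriction-∘ (deleteLeaf T φ j three-vertices)
      (restrict N _ _ g′ g′-injective))
  where
  missed : ∃ λ j → ¬ ∃ λ x → g x ≡ j
  missed = ¬∀⟶∃¬ (suc N) _ (λ y → anyᶠ? (λ x → g x ≟ᶠ y)) g-not-surjective
  j : Fin (suc N)
  j = proj₁ missed
  j∉g : ∀ x → j ≢ g x
  j∉g x e = proj₂ missed (x , sym e)
  g′ : Fin (suc (suc N′)) → Fin N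
  g′ x = punchOut (j∉g x)
  g′-injective : Injective _≡_ _≡_ g′
  g′-injective e = g-injective (punchOut-injective (j∉g _) (j∉g _) e)
  three-vertices : 3 ≤ m T
  three-vertices = ℕ.≤-trans (s≤s (s≤s (s≤s z≤n)))
    (ℕ.≤-trans (s≤s (injective⇒≤ g′-injective)) (injective⇒≤ (leafVertex-injective T φ)))

-- Pulling back cycle porosity

Arc : Digraph → Set
Arc D = Fin (n D) × Fin (n D)

porosity-resp-⇔ : ∀ {D : Digraph} {X Y : Fin (n D) → Set} {k} → (∀ v → X v ⇔ Y v) →
                  PorosityAtMost D X k → PorosityAtMost D Y k
porosity-resp-⇔ {D} {X} {Y} X⇔Y P F disjoint L unique crossing = P F disjoint L unique (All.map back crossing)
  where
  open Equivalence
  back : ∀ {z} → Crossing Y z × InFamily D F z → Crossing X z × InFamily D F z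
  back (inj₁ (y , ¬y) , inF) = inj₁ (from (X⇔Y _) y , ¬y ∘ to (X⇔Y _)) , inF
  back (inj₂ (¬y , y) , inF) = inj₂ (¬y ∘ to (X⇔Y _) , from (X⇔Y _) y) , inF

cycw-pullback : ∀ (D D′ : Digraph) (g : Fin (n D′) → Fin (n D)) → Injective _≡_ _≡_ g → ∀ k →
                (∀ X → PorosityAtMost D X k → PorosityAtMost D′ (X ∘ g) k) →
                CycwAtMost D k → CycwAtMost D′ k
cycw-pullback D D′ g g-injective k pullback (dec , width) =
  record { tree = subtree ; φ = labelling } ,
  λ x y xy → let c , d , cd , same = edge-image x y xy
             in porosity-resp-⇔ {D′} {edgeSide dec c d ∘ g} {Side subtree labelling x y}
                  (λ v → ⇔-sym (same v)) (pullback _ (width c d cd))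
  where open Restriction (restrict (n D) (tree dec) (φ dec) g g-injective)

allPairs-map-on : ∀ {A : Set} {P : A → Set} {R S : A → A → Set} {xs} → All P xs →
                  (∀ {x y} → P x → P y → R x y → S x y) → AllPairs R xs → AllPairs S xs
allPairs-map-on []         f []         = []
allPairs-map-on (px ∷ pxs) f (rs ∷ rss) = All.zipWith (λ (py , r) → f px py r) (pxs , rs) ∷ allPairs-map-on pxs f rss

-- An injection of the arcs of F′ crossing Y into arcs of a disjoint family of D crossing X
-- shows that the porosity of Y on F′ is bounded by that of X.
record FamilyImage (D D′ : Digraph) (X : Fin (n D) → Set) (Y : Fin (n D′) → Set)
                   (F′ : List (DCycle D′)) : Set where
  field
    family           : List (DCycle D)
    disjoint         : DisjointFamily D family
    arcMap           : Arc D′ → Arc D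
    arcMap-injective : ∀ {z z′} → InFamily D′ F′ z → InFamily D′ F′ z′ → arcMap z ≡ arcMap z′ → z ≡ z′
    arcMap-crossing  : ∀ {z} → InFamily D′ F′ z → Crossing Y z → Crossing X (arcMap z)
    arcMap-inFamily  : ∀ {z} → InFamily D′ F′ z → InFamily D family (arcMap z)

porosity-transfer : ∀ {D D′ : Digraph} {X Y k} →
                    (∀ F′ → DisjointFamily D′ F′ → FamilyImage D D′ X Y F′) →
                    PorosityAtMost D X k → PorosityAtMost D′ Y k
porosity-transfer {k = k} image P F′ disjoint′ L unique crossing =
  subst (_≤ k) (length-map arcMap L)
    (P family disjoint (map arcMap L)
       (AllPairs.map⁺ (allPairs-map-on crossing
         (λ (_ , inF) (_ , inF′) z≢z′ e → z≢z′ (arcMap-injective inF inF′ e)) unique))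
       (All.map⁺ (All.map (λ (c , inF) → arcMap-crossing inF c , arcMap-inFamily inF) crossing)))
  where open FamilyImage (image F′ disjoint′)

module _ {A : Set} where

  pathPairs-++ : ∀ (a : A) xs y ys e → pathPairs a (xs ++ y ∷ ys) e ≡ pathPairs a xs y ++ pathPairs y ys e
  pathPairs-++ a []       y ys e = refl
  pathPairs-++ a (x ∷ xs) y ys e = cong ((a , x) ∷_) (pathPairs-++ x xs y ys e)

  pathPairs-ends : ∀ {x y : A} a vs e → (x , y) ∈ pathPairs a vs e → x ∈ a ∷ vs × y ∈ vs ++ e ∷ []
  pathPairs-ends a []       e (here refl) = here refl , here refl
  pathPairs-ends a (b ∷ vs) e (here refl) = here refl , here refl
  pathPairs-ends a (b ∷ vs) e (there xy∈) =
    let x∈ , y∈ = pathPairs-ends b vs e xy∈ in there x∈ , there y∈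

  cyclicPairs-ends : ∀ {x y : A} vs → (x , y) ∈ cyclicPairs vs → x ∈ vs × y ∈ vs
  cyclicPairs-ends (v ∷ vs) xy∈ with pathPairs-ends v vs v xy∈
  ... | x∈ , y∈ with ∈-++⁻ vs y∈
  ...   | inj₁ y∈vs        = x∈ , there y∈vs
  ...   | inj₂ (here refl) = x∈ , here refl

  cyclicPairs-rotate : ∀ xs ys → cyclicPairs (xs ++ ys) ↭ cyclicPairs (ys ++ xs)
  cyclicPairs-rotate [] ys = ↭-reflexive (cong cyclicPairs (sym (++-identityʳ ys)))
  cyclicPairs-rotate (x ∷ xs) [] = ↭-reflexive (cong cyclicPairs (++-identityʳ (x ∷ xs)))
  cyclicPairs-rotate (x ∷ xs) (y ∷ ys) = begin
    pathPairs x (xs ++ y ∷ ys) x               ≡⟨ pathPairs-++ x xs y ys x ⟩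
    pathPairs x xs y ++ pathPairs y ys x       ↭⟨ ++-comm (pathPairs x xs y) _ ⟩
    pathPairs y ys x ++ pathPairs x xs y       ≡⟨ pathPairs-++ y ys x xs y ⟨
    pathPairs y (ys ++ x ∷ xs) y               ∎
    where open PermutationReasoning

  -- ws is vs read cyclically from another starting point, as far as its vertices and arcs go
  record Rotation (vs ws : List A) : Set where
    field
      vertices : vs ↭ ws
      pairs    : cyclicPairs vs ↭ cyclicPairs ws

  rotation : ∀ xs ys → Rotation (xs ++ ys) (ys ++ xs)
  rotation xs ys = record { vertices = ++-comm xs ys ; pairs = cyclicPairs-rotate xs ys }

  rotation-trans : ∀ {us vs ws} → Rotation us vs → Rotation vs ws → Rotation us ws
  rotation-trans r r′ = record
    { vertices = ↭-trans (Rotation.vertices r) (Rotation.vertices r′)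
    ; pairs    = ↭-trans (Rotation.pairs r) (Rotation.pairs r′) }

  unique-rotation : ∀ {vs ws} → Rotation vs ws → Unique vs → Unique ws
  unique-rotation r = Permutationₛ.Unique-resp-↭ (setoid A) (↭⇒↭ₛ (Rotation.vertices r))

  rotate-to-front : ∀ {x : A} {vs} → x ∈ vs → Σ (List A) λ rest → Rotation vs (x ∷ rest)
  rotate-to-front {x} x∈ with ∈-∃++ x∈
  ... | xs , ys , refl = ys ++ xs , rotation xs (x ∷ ys)

rotate-cycle : ∀ {m} {R} {vs ws : List (Fin m)} → Rotation vs ws → IsCycle R vs → NonEmpty ws → IsCycle R ws
rotate-cycle r (_ , unique , arcs) ne = ne , unique-rotation r unique , All-resp-↭ (Rotation.pairs r) arcs

both : ∀ {A B : Set} → (A → B) → A × A → B × B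
both f = Product.map f f

both-injective : ∀ {A B : Set} {f : A → B} → Injective _≡_ _≡_ f → Injective _≡_ _≡_ (both f)
both-injective f-injective e = cong₂ _,_ (f-injective (cong proj₁ e)) (f-injective (cong proj₂ e))

module _ {A B : Set} (f : A → B) where

  pathPairs-map : ∀ a vs e → pathPairs (f a) (map f vs) (f e) ≡ map (both f) (pathPairs a vs e)
  pathPairs-map a vs e = trans (cong (zip (f a ∷ map f vs)) (sym (map-++ f vs (e ∷ []))))
                               (zip-map f f (a ∷ vs) (vs ++ e ∷ []))

  cyclicPairs-map : ∀ vs → cyclicPairs (map f vs) ≡ map (both f) (cyclicPairs vs)
  cyclicPairs-map []       = refl
  cyclicPairs-map (v ∷ vs) = pathPairs-map v vs v

  ∈-pathPairs-map : ∀ a vs e {p q} → (p , q) ∈ pathPairs a vs e → (f p , f q) ∈ pathPairs (f a) (map f vs) (f e)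
  ∈-pathPairs-map a vs e pq∈ = subst (_ ∈_) (sym (pathPairs-map a vs e)) (∈-map⁺ (both f) pq∈)

  ∈-cyclicPairs-map : ∀ vs {p q} → (p , q) ∈ cyclicPairs vs → (f p , f q) ∈ cyclicPairs (map f vs)
  ∈-cyclicPairs-map vs pq∈ = subst (_ ∈_) (sym (cyclicPairs-map vs)) (∈-map⁺ (both f) pq∈)

map-isCycle : ∀ {m m′} {R : Rel₂ m} {R′ : Rel₂ m′} {f : Fin m → Fin m′} → Injective _≡_ _≡_ f → ∀ {vs} →
              (∀ {p q} → (p , q) ∈ cyclicPairs vs → R′ (f p) (f q) ≡ true) →
              IsCycle R vs → IsCycle R′ (map f vs)
map-isCycle {R′ = R′} {f} f-injective {vs} arcs (nonEmpty , unique , _) =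
  nonEmpty , Unique.map⁺ f-injective unique ,
  subst (Arcs R′) (sym (cyclicPairs-map f vs)) (All.map⁺ (tabulate λ {(p , q)} → arcs))

disjoint-map : ∀ {A B : Set} {f : A → B} → Injective _≡_ _≡_ f → ∀ {xs ys} →
               Disjoint xs ys → Disjoint (map f xs) (map f ys)
disjoint-map {f = f} f-injective disjoint (x∈ , y∈) with ∈-map⁻ f x∈ | ∈-map⁻ f y∈
... | x , x∈xs , refl | y , y∈ys , e = disjoint (x∈xs , subst (_∈ _) (sym (f-injective e)) y∈ys)

module SubgraphPullback (D D′ : Digraph) (ι : Fin (n D′) → Fin (n D)) (ι-injective : Injective _≡_ _≡_ ι)
  (ι-arcs : ∀ x y → arc D′ x y ≡ true → arc D (ι x) (ι y) ≡ true) where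

  mapCycle : DCycle D′ → DCycle D
  mapCycle (vs , isCycle@(_ , _ , arcs)) = map ι vs , map-isCycle ι-injective (ι-arcs _ _ ∘ lookup arcs) isCycle

  inFamily-map : ∀ {F z} → InFamily D′ F z → InFamily D (map mapCycle F) (both ι z)
  inFamily-map {C ∷ _} (here z∈) = here (∈-cyclicPairs-map ι (proj₁ C) z∈)
  inFamily-map (there inF) = there (inFamily-map inF)

  subgraph-pullback : ∀ {k} X → PorosityAtMost D X k → PorosityAtMost D′ (X ∘ ι) k
  subgraph-pullback X = porosity-transfer {D} {D′} {X} {X ∘ ι} λ F′ disjoint′ → record
    { family           = map mapCycle F′
    ; disjoint         = AllPairs.map⁺ (AllPairs.map (disjoint-map ι-injective) disjoint′)
    ; arcMap           = both ι
    ; arcMap-injective = λ _ _ → both-injective ι-injective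
    ; arcMap-crossing  = λ _ c → c
    ; arcMap-inFamily  = inFamily-map
    }

cycw-subgraph : ∀ {H D k} → Subgraph H D → CycwAtMost D k → CycwAtMost H k
cycw-subgraph {H} {D} {k} (ι , ι-injective , ι-arcs) =
  cycw-pullback D H ι ι-injective k (SubgraphPullback.subgraph-pullback D H ι ι-injective ι-arcs)

-- Lifting cycles along a contraction

record SpecialFirst {V : Set} (Special : V → V → Set) (vs : List V) : Set where
  field
    s₀ s₁   : V
    rest    : List V
    rotated : Rotation vs (s₀ ∷ s₁ ∷ rest)
    special : Special s₀ s₁

-- A section g of a contraction map f : V(D) → V(D′) along which cycles of D′ lift to D.
-- Only the special arcs at the contracted vertex x₀ may fail to lift; they then lift
-- to a path of length two through the vertex o outside the image of g.
record CycleLifting (D D′ : Digraph) : Set₁ where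
  field
    f                : Fin (n D) → Fin (n D′)
    g                : Fin (n D′) → Fin (n D)
    f∘g              : ∀ y → f (g y) ≡ y
    x₀               : Fin (n D′)
    o                : Fin (n D)
    f-o              : f o ≡ x₀
    g≢o              : ∀ y → g y ≢ o
    Special          : Fin (n D′) → Fin (n D′) → Set
    special?         : ∀ p q → Dec (Special p q)
    special-at-x₀    : ∀ {p q} → Special p q → p ≡ x₀ ⊎ q ≡ x₀
    nonspecial-lifts : ∀ {p q} → arc D′ p q ≡ true → ¬ Special p q → arc D (g p) (g q) ≡ true
    detour           : ∀ {p q} → arc D′ p q ≡ true → arc D (g p) (g q) ≡ false →
                       arc D (g p) o ≡ true × arc D o (g q) ≡ true
    special-first    : (C : DCycle D′) → x₀ ∈ proj₁ C → SpecialFirst Special (proj₁ C)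
    special-once     : ∀ {s₀ s₁ rest} → Unique (s₀ ∷ s₁ ∷ rest) → Special s₀ s₁ →
                       ∀ {p q} → (p , q) ∈ pathPairs s₁ rest s₀ → ¬ Special p q

module Lifting {D D′ : Digraph} (L : CycleLifting D D′) where
  open CycleLifting L

  g-injective : Injective _≡_ _≡_ g
  g-injective {x} {y} e = trans (sym (f∘g x)) (trans (cong f e) (f∘g y))

  -- the arcs of D that may represent the arc (p , q) of D′
  data ArcImage (p q : Fin (n D′)) (z : Arc D) : Set where
    direct     : arc D (g p) (g q) ≡ true  → z ≡ (g p , g q) → ArcImage p q z
    detour-in  : arc D (g p) (g q) ≡ false → z ≡ (g p , o)   → ArcImage p q z
    detour-out : arc D (g p) (g q) ≡ false → z ≡ (o , g q)   → ArcImage p q z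

  record Lift (C : DCycle D′) : Set where
    field
      cycle          : DCycle D
      vertices-above : ∀ {y} → y ∈ proj₁ cycle → f y ∈ proj₁ C
      arcs-above     : ∀ {p q z} → (p , q) ∈ cyclicPairs (proj₁ C) → ArcImage p q z → z ∈ cyclicPairs (proj₁ cycle)

  ArcsLift : List (Fin (n D′)) → Set
  ArcsLift vs = ∀ {p q} → (p , q) ∈ cyclicPairs vs → arc D (g p) (g q) ≡ true

  direct-image : ∀ {p q z} → arc D (g p) (g q) ≡ true → ArcImage p q z → z ≡ (g p , g q)
  direct-image _  (direct _ z≡)       = z≡
  direct-image pq (detour-in ¬pq _)  = ⊥-elim (true≢false (trans (sym pq) ¬pq))
  direct-image pq (detour-out ¬pq _) = ⊥-elim (true≢false (trans (sym pq) ¬pq))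

  direct-arcs : ∀ {vs} → ArcsLift vs → ∀ {p q z} → (p , q) ∈ cyclicPairs vs → ArcImage p q z →
                z ∈ cyclicPairs (map g vs)
  direct-arcs {vs} lifts pq∈ im rewrite direct-image (lifts pq∈) im = ∈-cyclicPairs-map g vs pq∈

  in-map : ∀ {vs y} → y ∈ map g vs → f y ∈ vs
  in-map {vs} y∈ with ∈-map⁻ g y∈
  ... | x , x∈ , refl = subst (_∈ vs) (sym (f∘g x)) x∈

  lift-avoiding : (C : DCycle D′) → ¬ x₀ ∈ proj₁ C → Lift C
  lift-avoiding (vs , isCycle@(_ , _ , arcs)) x₀∉ = record
    { cycle          = map g vs , map-isCycle g-injective lifts isCycle
    ; vertices-above = in-map
    ; arcs-above     = direct-arcs {vs} lifts
    }
    where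
    lifts : ArcsLift vs
    lifts pq∈ = nonspecial-lifts (lookup arcs pq∈) λ sp →
      x₀∉ ([ (λ { refl → proj₁ (cyclicPairs-ends vs pq∈) }) , (λ { refl → proj₂ (cyclicPairs-ends vs pq∈) }) ]
             (special-at-x₀ sp))

  module Through (C : DCycle D′) (x₀∈ : x₀ ∈ proj₁ C) where
    vs : List (Fin (n D′))
    vs = proj₁ C
    isCycle : IsCycle (arc D′) vs
    isCycle = proj₂ C
    open SpecialFirst (special-first C x₀∈)
    rotated-cycle : IsCycle (arc D′) (s₀ ∷ s₁ ∷ rest)
    rotated-cycle = rotate-cycle rotated isCycle nonEmpty
    rotated-unique : Unique (s₀ ∷ s₁ ∷ rest)
    rotated-unique = proj₁ (proj₂ rotated-cycle)
    rotated-arcs : Arcs (arc D′) (cyclicPairs (s₀ ∷ s₁ ∷ rest))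
    rotated-arcs = proj₂ (proj₂ rotated-cycle)
    to-rotated : ∀ {z} → z ∈ cyclicPairs vs → z ∈ cyclicPairs (s₀ ∷ s₁ ∷ rest)
    to-rotated = ∈-resp-↭ (Rotation.pairs rotated)
    from-rotated : ∀ {y} → y ∈ s₀ ∷ s₁ ∷ rest → y ∈ vs
    from-rotated = ∈-resp-↭ (↭-sym (Rotation.vertices rotated))
    others-lift : ∀ {p q} → (p , q) ∈ pathPairs s₁ rest s₀ → arc D (g p) (g q) ≡ true
    others-lift pq∈ = nonspecial-lifts (lookup rotated-arcs (there pq∈)) (special-once rotated-unique special pq∈)

    special-unique : ∀ {p q p′ q′} → (p , q) ∈ cyclicPairs vs → (p′ , q′) ∈ cyclicPairs vs →
                     Special p q → Special p′ q′ → (p , q) ≡ (p′ , q′)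
    special-unique pq∈ pq∈′ sp sp′ with to-rotated pq∈ | to-rotated pq∈′
    ... | here refl  | here refl   = refl
    ... | here _     | there pq∈′′ = ⊥-elim (special-once rotated-unique special pq∈′′ sp′)
    ... | there pq∈′′ | _          = ⊥-elim (special-once rotated-unique special pq∈′′ sp)

    lift : Lift C
    lift with arc D (g s₀) (g s₁) in lifts₀₁
    ... | true = record
      { cycle          = map g (s₀ ∷ s₁ ∷ rest) , map-isCycle g-injective lifts rotated-cycle
      ; vertices-above = λ y∈ → from-rotated (in-map y∈)
      ; arcs-above     = λ pq∈ → direct-arcs {s₀ ∷ s₁ ∷ rest} lifts (to-rotated pq∈)
      }
      where
      lifts : ArcsLift (s₀ ∷ s₁ ∷ rest)
      lifts (here refl)  = lifts₀₁
      lifts (there pq∈) = others-lift pq∈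
    ... | false = record
      { cycle          = g s₀ ∷ o ∷ map g (s₁ ∷ rest) , nonEmpty , unique , arcs
      ; vertices-above = vertices-above
      ; arcs-above     = λ pq∈ → arcs-above (to-rotated pq∈)
      }
      where
      unique : Unique (g s₀ ∷ o ∷ map g (s₁ ∷ rest))
      unique with Unique.map⁺ g-injective rotated-unique
      ... | g₀∉ ∷ u = (g≢o s₀ ∷ g₀∉) ∷ All.map⁺ (tabulate λ {y} _ o≡ → g≢o y (sym o≡)) ∷ u
      arcs : Arcs (arc D) (cyclicPairs (g s₀ ∷ o ∷ map g (s₁ ∷ rest)))
      arcs = let via-o = detour (lookup rotated-arcs (here refl)) lifts₀₁ in
        proj₁ via-o ∷ proj₂ via-o ∷
        subst (Arcs (arc D)) (sym (pathPairs-map g s₁ rest s₀))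
              (All.map⁺ (tabulate λ {(p , q)} → others-lift))
      vertices-above : ∀ {y} → y ∈ g s₀ ∷ o ∷ map g (s₁ ∷ rest) → f y ∈ vs
      vertices-above (here refl)         = from-rotated (here (f∘g s₀))
      vertices-above (there (here refl)) = subst (_∈ vs) (sym f-o) x₀∈
      vertices-above (there (there y∈))  = from-rotated (there (in-map y∈))
      arcs-above : ∀ {p q z} → (p , q) ∈ cyclicPairs (s₀ ∷ s₁ ∷ rest) → ArcImage p q z →
                   z ∈ cyclicPairs (g s₀ ∷ o ∷ map g (s₁ ∷ rest))
      arcs-above (here refl) (direct lifts _)    = ⊥-elim (true≢false (trans (sym lifts) lifts₀₁))
      arcs-above (here refl) (detour-in _ refl)  = here refl
      arcs-above (here refl) (detour-out _ refl) = there (here refl)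
      arcs-above (there pq∈) im rewrite direct-image (others-lift pq∈) im =
        there (there (∈-pathPairs-map g s₁ rest s₀ pq∈))

  lift : (C : DCycle D′) → Lift C
  lift C with any? (x₀ ≟ᶠ_) (proj₁ C)
  ... | yes x₀∈ = Through.lift C x₀∈
  ... | no  x₀∉ = lift-avoiding C x₀∉

  special-touches : ∀ {vs p q} → (p , q) ∈ cyclicPairs vs → Special p q → x₀ ∈ vs
  special-touches {vs} pq∈ sp with special-at-x₀ sp
  ... | inj₁ refl = proj₁ (cyclicPairs-ends vs pq∈)
  ... | inj₂ refl = proj₂ (cyclicPairs-ends vs pq∈)

  special-unique-in-cycle : ∀ (C : DCycle D′) {p q p′ q′} →
    (p , q) ∈ cyclicPairs (proj₁ C) → (p′ , q′) ∈ cyclicPairs (proj₁ C) →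
    Special p q → Special p′ q′ → (p , q) ≡ (p′ , q′)
  special-unique-in-cycle C pq∈ pq∈′ sp sp′ = Through.special-unique C (special-touches pq∈ sp) pq∈ pq∈′ sp sp′

  special-unique-in-family : ∀ {F p q p′ q′} → DisjointFamily D′ F →
    InFamily D′ F (p , q) → InFamily D′ F (p′ , q′) → Special p q → Special p′ q′ → (p , q) ≡ (p′ , q′)
  special-unique-in-family {C ∷ _} _ (here pq∈) (here pq∈′) sp sp′ = special-unique-in-cycle C pq∈ pq∈′ sp sp′
  special-unique-in-family (C# ∷ _) (here pq∈) (there inF′) sp sp′ =
    ⊥-elim (All.lookupWith (λ disjoint pq∈′ → disjoint (special-touches pq∈ sp , special-touches pq∈′ sp′)) C# inF′)
  special-unique-in-family (C# ∷ _) (there inF) (here pq∈′) sp sp′ =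
    ⊥-elim (All.lookupWith (λ disjoint pq∈ → disjoint (special-touches pq∈′ sp′ , special-touches pq∈ sp)) C# inF)
  special-unique-in-family (_ ∷ disjoint) (there inF) (there inF′) sp sp′ =
    special-unique-in-family disjoint inF inF′ sp sp′

  arc-in-family : ∀ {F p q} → InFamily D′ F (p , q) → arc D′ p q ≡ true
  arc-in-family {C ∷ _} (here pq∈) = lookup (proj₂ (proj₂ (proj₂ C))) pq∈
  arc-in-family (there inF) = arc-in-family inF

  detour⇒special : ∀ {F p q} → InFamily D′ F (p , q) → arc D (g p) (g q) ≡ false → Special p q
  detour⇒special {p = p} {q} inF ¬lifts with special? p q
  ... | yes sp = sp
  ... | no ¬sp = ⊥-elim (true≢false (trans (sym (nonspecial-lifts (arc-in-family inF) ¬sp)) ¬lifts))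

  images-injective : ∀ {F p q p′ q′ z} → DisjointFamily D′ F → InFamily D′ F (p , q) → InFamily D′ F (p′ , q′) →
                     ArcImage p q z → ArcImage p′ q′ z → (p , q) ≡ (p′ , q′)
  images-injective _ _ _ (direct _ refl) (direct _ e) = both-injective g-injective e
  images-injective _ _ _ (direct _ refl) (detour-in _ e) = ⊥-elim (g≢o _ (cong proj₂ e))
  images-injective _ _ _ (direct _ refl) (detour-out _ e) = ⊥-elim (g≢o _ (cong proj₁ e))
  images-injective _ _ _ (detour-in _ refl) (direct _ e) = ⊥-elim (g≢o _ (sym (cong proj₂ e)))
  images-injective _ _ _ (detour-out _ refl) (direct _ e) = ⊥-elim (g≢o _ (sym (cong proj₁ e)))
  images-injective _ _ _ (detour-in _ refl) (detour-out _ e) = ⊥-elim (g≢o _ (cong proj₁ e))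
  images-injective _ _ _ (detour-out _ refl) (detour-in _ e) = ⊥-elim (g≢o _ (sym (cong proj₁ e)))
  images-injective disjoint inF inF′ (detour-in ¬lifts _) (detour-in ¬lifts′ _) =
    special-unique-in-family disjoint inF inF′ (detour⇒special inF ¬lifts) (detour⇒special inF′ ¬lifts′)
  images-injective disjoint inF inF′ (detour-out ¬lifts _) (detour-out ¬lifts′ _) =
    special-unique-in-family disjoint inF inF′ (detour⇒special inF ¬lifts) (detour⇒special inF′ ¬lifts′)

  module Representative (X : Fin (n D) → Set) (X? : ∀ y → Dec (X y)) where

    -- o lies on the side of g p or of g q, so one half of the detour crosses the cut
    detourArc : ∀ p q → Dec (X o) → Dec (X (g q)) → Arc D
    detourArc p q (yes _) (yes _) = g p , o
    detourArc p q (yes _) (no _)  = o , g q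
    detourArc p q (no _)  (yes _) = o , g q
    detourArc p q (no _)  (no _)  = g p , o

    detourArc-crossing : ∀ p q o? q? → Crossing X (g p , g q) → Crossing X (detourArc p q o? q?)
    detourArc-crossing p q (yes xo) (yes xq) (inj₁ (_ , ¬xq)) = ⊥-elim (¬xq xq)
    detourArc-crossing p q (yes xo) (yes xq) (inj₂ (¬xp , _)) = inj₂ (¬xp , xo)
    detourArc-crossing p q (yes xo) (no ¬xq) _                = inj₁ (xo , ¬xq)
    detourArc-crossing p q (no ¬xo) (yes xq) _                = inj₂ (¬xo , xq)
    detourArc-crossing p q (no ¬xo) (no ¬xq) (inj₁ (xp , _))  = inj₁ (xp , ¬xo)
    detourArc-crossing p q (no ¬xo) (no ¬xq) (inj₂ (_ , xq))  = ⊥-elim (¬xq xq)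

    detourArc-image : ∀ p q o? q? → arc D (g p) (g q) ≡ false → ArcImage p q (detourArc p q o? q?)
    detourArc-image p q (yes _) (yes _) ¬lifts = detour-in ¬lifts refl
    detourArc-image p q (yes _) (no _)  ¬lifts = detour-out ¬lifts refl
    detourArc-image p q (no _)  (yes _) ¬lifts = detour-out ¬lifts refl
    detourArc-image p q (no _)  (no _)  ¬lifts = detour-in ¬lifts refl

    representativeᵇ : Fin (n D′) → Fin (n D′) → Bool → Arc D
    representativeᵇ p q true  = g p , g q
    representativeᵇ p q false = detourArc p q (X? o) (X? (g q))

    representative : Arc D′ → Arc D
    representative (p , q) = representativeᵇ p q (arc D (g p) (g q))

    representative-image : ∀ p q → ArcImage p q (representative (p , q))
    representative-image p q with arc D (g p) (g q) in lifts
    ... | true  = direct lifts refl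
    ... | false = detourArc-image p q (X? o) (X? (g q)) lifts

    representative-crossing : ∀ p q → Crossing X (g p , g q) → Crossing X (representative (p , q))
    representative-crossing p q c with arc D (g p) (g q)
    ... | true  = c
    ... | false = detourArc-crossing p q (X? o) (X? (g q)) c

    lifted-family : ∀ F → DisjointFamily D′ F → FamilyImage D D′ X (X ∘ g) F
    lifted-family F disjoint = record
      { family           = map (Lift.cycle ∘ lift) F
      ; disjoint         = AllPairs.map⁺ (AllPairs.map lifts-disjoint disjoint)
      ; arcMap           = representative
      ; arcMap-injective = λ {(p , q)} {(p′ , q′)} inF inF′ e →
          images-injective disjoint inF inF′ (representative-image p q)
            (subst (ArcImage p′ q′) (sym e) (representative-image p′ q′))
      ; arcMap-crossing  = λ {(p , q)} _ → representative-crossing p q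
      ; arcMap-inFamily  = in-lifted-family
      }
      where
      lifts-disjoint : ∀ {C C′} → Disjoint (proj₁ C) (proj₁ C′) →
                       Disjoint (proj₁ (Lift.cycle (lift C))) (proj₁ (Lift.cycle (lift C′)))
      lifts-disjoint {C} {C′} disjointCC′ (y∈ , y∈′) =
        disjointCC′ (Lift.vertices-above (lift C) y∈ , Lift.vertices-above (lift C′) y∈′)

      in-lifted-family : ∀ {F z} → InFamily D′ F z → InFamily D (map (Lift.cycle ∘ lift) F) (representative z)
      in-lifted-family {C ∷ _} {p , q} (here pq∈) = here (Lift.arcs-above (lift C) pq∈ (representative-image p q))
      in-lifted-family (there inF) = there (in-lifted-family inF)

¬¬-decidable : ∀ {m} (X : Fin m → Set) → ¬ ¬ (∀ y → Dec (X y))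
¬¬-decidable {zero}  X k = k λ ()
¬¬-decidable {suc m} X k = ¬¬-excluded-middle λ X₀? → ¬¬-decidable (X ∘ suc) λ X? →
  k λ { zero → X₀? ; (suc y) → X? y }

-- X need not be decidable, but the conclusion is, so we may decide X classically.
lifting-pullback : ∀ {D D′} (lifting : CycleLifting D D′) → ∀ {k} X → PorosityAtMost D X k →
                   PorosityAtMost D′ (X ∘ CycleLifting.g lifting) k
lifting-pullback lifting {k} X P F disjoint arcs unique crossing with length arcs ≤? k
... | yes ok = ok
... | no too-long = ⊥-elim (¬¬-decidable X λ X? →
  too-long (porosity-transfer (Lifting.Representative.lifted-family lifting X X?) P F disjoint arcs unique crossing))

no-loop-cycle : ∀ (D : Digraph) {x} → ¬ IsCycle (arc D) (x ∷ [])
no-loop-cycle D {x} (_ , _ , xx ∷ []) = true≢false (trans (sym xx) (loopless D x))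

rotate-cycle-to-second : ∀ (D : Digraph) ((vs , isCycle) : DCycle D) {x} → x ∈ vs →
                         Σ (Fin (n D)) λ w → Σ (List (Fin (n D))) λ rest → Rotation vs (w ∷ x ∷ rest)
rotate-cycle-to-second D (vs , isCycle) {x} x∈ with rotate-to-front x∈
... | rest , r with initLast rest
...   | []          = ⊥-elim (no-loop-cycle D (rotate-cycle r isCycle nonEmpty))
...   | rest′ ∷ʳ′ w = w , rest′ , rotation-trans r (rotation (x ∷ rest′) (w ∷ []))

rotate-cycle-to : ∀ (D : Digraph) ((vs , isCycle) : DCycle D) {x} → x ∈ vs →
                  Σ (Fin (n D)) λ s → Σ (List (Fin (n D))) λ rest → Rotation vs (x ∷ s ∷ rest)
rotate-cycle-to D (vs , isCycle) x∈ with rotate-to-front x∈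
... | []       , r = ⊥-elim (no-loop-cycle D (rotate-cycle r isCycle nonEmpty))
... | s ∷ rest , r = s , rest , r

module Contraction {D D′ : Digraph} {u v : Fin (n D)} (uv : arc D u v ≡ true)
  (f : Fin (n D) → Fin (n D′)) (fu≡fv : f u ≡ f v) (f-surjective : ∀ y → ∃ λ x → f x ≡ y)
  (f-identifies : ∀ x y → f x ≡ f y → x ≡ y ⊎ ((x ≡ u ⊎ x ≡ v) × (y ≡ u ⊎ y ≡ v)))
  (f-arcs : ∀ p q → arc D′ p q ≡ true → Σ (Fin (n D)) λ x → Σ (Fin (n D)) λ y →
            f x ≡ p × f y ≡ q × arc D x y ≡ true × ¬ ((x ≡ u ⊎ x ≡ v) × (y ≡ u ⊎ y ≡ v))) where

  x₀ : Fin (n D′)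
  x₀ = f u

  f-uv : ∀ {z} → z ≡ u ⊎ z ≡ v → f z ≡ x₀
  f-uv (inj₁ refl) = refl
  f-uv (inj₂ refl) = sym fu≡fv

  f⁻¹-x₀ : ∀ {z} → f z ≡ x₀ → z ≡ u ⊎ z ≡ v
  f⁻¹-x₀ {z} e with f-identifies z u e
  ... | inj₁ refl    = inj₁ refl
  ... | inj₂ (z∈ , _) = z∈

  u≢v : u ≢ v
  u≢v refl = true≢false (trans (sym uv) (loopless D u))

  -- a section g of f, choosing the endpoint c of the contracted arc over x₀; o is the other endpoint
  module Section (c o : Fin (n D)) (c∈uv : c ≡ u ⊎ c ≡ v) (o∈uv : o ≡ u ⊎ o ≡ v) (c≢o : c ≢ o) where
    abstract
      g : Fin (n D′) → Fin (n D)
      g y with y ≟ᶠ x₀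
      ... | yes _ = c
      ... | no  _ = proj₁ (f-surjective y)

      f∘g : ∀ y → f (g y) ≡ y
      f∘g y with y ≟ᶠ x₀
      ... | yes refl = f-uv c∈uv
      ... | no  _    = proj₂ (f-surjective y)

      g-x₀ : g x₀ ≡ c
      g-x₀ with x₀ ≟ᶠ x₀
      ... | yes _   = refl
      ... | no x₀≢x₀ = ⊥-elim (x₀≢x₀ refl)

    g≢o : ∀ y → g y ≢ o
    g≢o y g≡o with y ≟ᶠ x₀
    ... | yes refl = c≢o (trans (sym g-x₀) g≡o)
    ... | no y≢x₀  = y≢x₀ (trans (sym (f∘g y)) (trans (cong f g≡o) (f-uv o∈uv)))

    g-outside : ∀ {y} → y ≢ x₀ → ¬ (g y ≡ u ⊎ g y ≡ v)
    g-outside {y} y≢x₀ g∈ = y≢x₀ (trans (sym (f∘g y)) (f-uv g∈))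

    f⁻¹ : ∀ {z y} → y ≢ x₀ → f z ≡ y → z ≡ g y
    f⁻¹ {z} {y} y≢x₀ e with f-identifies z (g y) (trans e (sym (f∘g y)))
    ... | inj₁ z≡    = z≡
    ... | inj₂ (_ , g∈) = ⊥-elim (g-outside y≢x₀ g∈)

    arc-away : ∀ {p q} → p ≢ x₀ → q ≢ x₀ → arc D′ p q ≡ true → arc D (g p) (g q) ≡ true
    arc-away {p} {q} p≢x₀ q≢x₀ pq with f-arcs p q pq
    ... | x , y , fx , fy , xy , _ = subst₂ (λ s t → arc D s t ≡ true) (f⁻¹ p≢x₀ fx) (f⁻¹ q≢x₀ fy) xy

    arc-into : ∀ {p} → p ≢ x₀ → arc D′ p x₀ ≡ true → arc D (g p) u ≡ true ⊎ arc D (g p) v ≡ true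
    arc-into {p} p≢x₀ px₀ with f-arcs p x₀ px₀
    ... | x , y , fx , fy , xy , _ with f⁻¹-x₀ fy
    ... | inj₁ refl = inj₁ (subst (λ s → arc D s u ≡ true) (f⁻¹ p≢x₀ fx) xy)
    ... | inj₂ refl = inj₂ (subst (λ s → arc D s v ≡ true) (f⁻¹ p≢x₀ fx) xy)

    arc-out-of : ∀ {q} → q ≢ x₀ → arc D′ x₀ q ≡ true → arc D u (g q) ≡ true ⊎ arc D v (g q) ≡ true
    arc-out-of {q} q≢x₀ x₀q with f-arcs x₀ q x₀q
    ... | x , y , fx , fy , xy , _ with f⁻¹-x₀ fx
    ... | inj₁ refl = inj₁ (subst (λ t → arc D u t ≡ true) (f⁻¹ q≢x₀ fy) xy)
    ... | inj₂ refl = inj₂ (subst (λ t → arc D v t ≡ true) (f⁻¹ q≢x₀ fy) xy)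

  no-loop-at-x₀ : arc D′ x₀ x₀ ≢ true
  no-loop-at-x₀ x₀x₀ = true≢false (trans (sym x₀x₀) (loopless D′ x₀))

  -- u's only out-neighbour is v: g x₀ = v, and only arcs into x₀ may need a detour through u
  out-lifting : (∀ w → arc D u w ≡ true → w ≡ v) → CycleLifting D D′
  out-lifting u-out = record
    { f                = f
    ; g                = g
    ; f∘g              = f∘g
    ; x₀               = x₀
    ; o                = u
    ; f-o              = refl
    ; g≢o              = g≢o
    ; Special          = λ p q → q ≡ x₀
    ; special?         = λ p q → q ≟ᶠ x₀
    ; special-at-x₀    = inj₂
    ; nonspecial-lifts = nonspecial-lifts
    ; detour           = detour
    ; special-first    = special-first
    ; special-once     = special-once
    }
    where
    open Section v u (inj₂ refl) (inj₁ refl) (u≢v ∘ sym)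

    nonspecial-lifts : ∀ {p q} → arc D′ p q ≡ true → q ≢ x₀ → arc D (g p) (g q) ≡ true
    nonspecial-lifts {p} {q} pq q≢x₀ with p ≟ᶠ x₀
    ... | no p≢x₀ = arc-away p≢x₀ q≢x₀ pq
    ... | yes refl with arc-out-of q≢x₀ pq
    ...   | inj₁ u→ = ⊥-elim (g-outside q≢x₀ (inj₂ (u-out _ u→)))
    ...   | inj₂ v→ = subst (λ s → arc D s (g q) ≡ true) (sym g-x₀) v→

    detour : ∀ {p q} → arc D′ p q ≡ true → arc D (g p) (g q) ≡ false → arc D (g p) u ≡ true × arc D u (g q) ≡ true
    detour {p} {q} pq ¬lifts with q ≟ᶠ x₀
    ... | no q≢x₀ = ⊥-elim (true≢false (trans (sym (nonspecial-lifts pq q≢x₀)) ¬lifts))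
    ... | yes refl with p ≟ᶠ x₀
    ...   | yes refl = ⊥-elim (no-loop-at-x₀ pq)
    ...   | no p≢x₀ with arc-into p≢x₀ pq
    ...     | inj₁ →u = →u , subst (λ t → arc D u t ≡ true) (sym g-x₀) uv
    ...     | inj₂ →v = ⊥-elim (true≢false (trans (sym →v) (subst (λ t → arc D (g p) t ≡ false) g-x₀ ¬lifts)))

    special-first : (C : DCycle D′) → x₀ ∈ proj₁ C → SpecialFirst (λ p q → q ≡ x₀) (proj₁ C)
    special-first C x₀∈ =
      let w , rest , r = rotate-cycle-to-second D′ C x₀∈
      in record { s₀ = w ; s₁ = x₀ ; rest = rest ; rotated = r ; special = refl }

    special-once : ∀ {s₀ s₁ rest} → Unique (s₀ ∷ s₁ ∷ rest) → s₁ ≡ x₀ →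
                   ∀ {p q} → (p , q) ∈ pathPairs s₁ rest s₀ → q ≢ x₀
    special-once {s₀} {s₁} {rest} ((s₀≢s₁ ∷ _) ∷ s₁∉rest ∷ _) refl {p} {q} pq∈ q≡x₀
      with ∈-++⁻ rest (proj₂ (pathPairs-ends s₁ rest s₀ pq∈))
    ... | inj₁ q∈rest     = lookup s₁∉rest q∈rest (sym q≡x₀)
    ... | inj₂ (here q≡s₀) = s₀≢s₁ (trans (sym q≡s₀) q≡x₀)

  -- v's only in-neighbour is u: g x₀ = u, and only arcs out of x₀ may need a detour through v
  in-lifting : (∀ w → arc D w v ≡ true → w ≡ u) → CycleLifting D D′
  in-lifting v-in = record
    { f                = f
    ; g                = g
    ; f∘g              = f∘g
    ; x₀               = x₀
    ; o                = v
    ; f-o              = sym fu≡fv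
    ; g≢o              = g≢o
    ; Special          = λ p q → p ≡ x₀
    ; special?         = λ p q → p ≟ᶠ x₀
    ; special-at-x₀    = inj₁
    ; nonspecial-lifts = nonspecial-lifts
    ; detour           = detour
    ; special-first    = special-first
    ; special-once     = special-once
    }
    where
    open Section u v (inj₁ refl) (inj₂ refl) u≢v

    nonspecial-lifts : ∀ {p q} → arc D′ p q ≡ true → p ≢ x₀ → arc D (g p) (g q) ≡ true
    nonspecial-lifts {p} {q} pq p≢x₀ with q ≟ᶠ x₀
    ... | no q≢x₀ = arc-away p≢x₀ q≢x₀ pq
    ... | yes refl with arc-into p≢x₀ pq
    ...   | inj₁ →u = subst (λ t → arc D (g p) t ≡ true) (sym g-x₀) →u
    ...   | inj₂ →v = ⊥-elim (g-outside p≢x₀ (inj₁ (v-in _ →v)))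

    detour : ∀ {p q} → arc D′ p q ≡ true → arc D (g p) (g q) ≡ false → arc D (g p) v ≡ true × arc D v (g q) ≡ true
    detour {p} {q} pq ¬lifts with p ≟ᶠ x₀
    ... | no p≢x₀ = ⊥-elim (true≢false (trans (sym (nonspecial-lifts pq p≢x₀)) ¬lifts))
    ... | yes refl with q ≟ᶠ x₀
    ...   | yes refl = ⊥-elim (no-loop-at-x₀ pq)
    ...   | no q≢x₀ with arc-out-of q≢x₀ pq
    ...     | inj₁ u→ = ⊥-elim (true≢false (trans (sym u→) (subst (λ s → arc D s (g q) ≡ false) g-x₀ ¬lifts)))
    ...     | inj₂ v→ = subst (λ s → arc D s v ≡ true) (sym g-x₀) uv , v→

    special-first : (C : DCycle D′) → x₀ ∈ proj₁ C → SpecialFirst (λ p q → p ≡ x₀) (proj₁ C)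
    special-first C x₀∈ =
      let s , rest , r = rotate-cycle-to D′ C x₀∈
      in record { s₀ = x₀ ; s₁ = s ; rest = rest ; rotated = r ; special = refl }

    special-once : ∀ {s₀ s₁ rest} → Unique (s₀ ∷ s₁ ∷ rest) → s₀ ≡ x₀ →
                   ∀ {p q} → (p , q) ∈ pathPairs s₁ rest s₀ → p ≢ x₀
    special-once {s₀} {s₁} {rest} (s₀∉ ∷ _) refl {p} {q} pq∈ p≡x₀ =
      lookup s₀∉ (proj₁ (pathPairs-ends s₁ rest s₀ pq∈)) (sym p≡x₀)

cycw-contraction : ∀ {D D′ k} → ContractionStep D D′ → CycwAtMost D k → CycwAtMost D′ k
cycw-contraction {D} {D′} {k} (u , v , (uv , only) , f , fu≡fv , f-surjective , f-identifies , f-arcs , _) =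
  cycw-pullback D D′ (CycleLifting.g lifting) (Lifting.g-injective lifting) k (lifting-pullback lifting)
  where
  open Contraction uv f fu≡fv f-surjective f-identifies f-arcs
  lifting : CycleLifting D D′
  lifting = [ out-lifting , in-lifting ] only

theorem3p12 : (D D′ : Digraph) → ButterflyMinor D′ D →
              (k : ℕ) → CycwAtMost D k → CycwAtMost D′ k
theorem3p12 D D′ (H , H⊆D , contractions) k =
  fold (λ D₁ D₂ → CycwAtMost D₁ k → CycwAtMost D₂ k) (λ step rest → rest ∘ cycw-contraction step) id contractions
  ∘ cycw-subgraph H⊆D
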